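{- If $\Gamma;\Delta\vdash t:\rho$ in $\lambda\mu$T, then $t\in\mathrm{SN}_A$, i.e. $t$ is strongly normalizing with respect to $\to_A$.
   Context: $\lambda\mu$T: types $\rho ::= \mathbb N\mid\sigma\to\tau$; terms/commands $t,r,s ::= x\mid\lambda x{:}\rho.r\mid ts\mid\mu\alpha{:}\rho.c\mid0\mid\mathsf S\,t\mid\mathsf{nrec}_\rho\ r\ s\ t$, $c::=[\alpha]t$ ($x$ $\lambda$-variables, $\alpha$ $\mu$-variables); $\overline n:=\mathsf S^n0$. Typing $\Gamma;\Delta\vdash t:\rho$, $\Gamma;\Delta\vdash c$: $x:\rho\in\Gamma\Rightarrow x:\rho$; $\Gamma,x{:}\sigma;\Delta\vdash t:\tau\Rightarrow\Gamma;\Delta\vdash\lambda x{:}\sigma.t:\sigma\to\tau$; $t:\sigma\to\tau$, $s:\sigma\Rightarrow ts:\tau$; $0:\mathbb N$; $t:\mathbb N\Rightarrow\mathsf St:\mathbb N$; $r:\rho$, $s:\mathbb N\to\rho\to\rho$, $t:\mathbb N\Rightarrow\mathsf{nrec}_\rho\ r\ s\ t:\rho$; $\Gamma;\Delta,\alpha{:}\rho\vdash c\Rightarrow\Gamma;\Delta\vdash\mu\alpha{:}\rho.c:\rho$; $\Gamma;\Delta\vdash t:\rho$, $\alpha:\rho\in\Delta\Rightarrow\Gamma;\Delta\vdash[\alpha]t$. Contexts $E ::= \Box \mid E\,t \mid \mathsf S\,E \mid \mathsf{nrec}\ r\ s\ E$; structural substitution $t[\alpha:=\beta E]$ replaces recursively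 each subcommand $[\alpha]q$ by $[\beta]E[q[\alpha:=\beta E]]$ (capture-avoiding). $\to_A$ is the compatible closure (on terms and commands) of: $(\lambda x.t)r \to t[x:=r]$; $\mathsf S(\mu\alpha.c)\to \mu\alpha.c[\alpha:=\alpha(\mathsf S\Box)]$; $(\mu\alpha.c)s\to\mu\alpha.c[\alpha:=\alpha(\Box s)]$; $\mathsf{nrec}\ r\ s\ 0\to r$; $\mathsf{nrec}\ r\ s\ (\mathsf S\,\overline n)\to s\ \overline n\ (\mathsf{nrec}\ r\ s\ \overline n)$; $\mathsf{nrec}\ r\ s\ (\mu\alpha.c)\to\mu\alpha.c[\alpha:=\alpha(\mathsf{nrec}\ r\ s\ \Box)]$. For a relation $\to_X$, $\mathrm{SN}_X$ is the inductively defined set: $t\in\mathrm{SN}_X$ if every $t'$ with $t\to_X t'$ lies in $\mathrm{SN}_X$. -}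

module Defs where

open import Data.Nat using (ℕ; zero; suc; _≟_)
open import Data.List using (List; []; _∷_)
open import Relation.Nullary using (yes; no)

data Ty : Set where
  Nat  : Ty
  _⇒_  : Ty → Ty → Ty

infixr 7 _⇒_

-- Raw terms and commands, de Bruijn indices in two separate namespaces:
-- λ-variables (var) and μ-variables (the index of a command [α]t and μ binder).
mutual
  data Tm : Set where
    var  : ℕ → Tm
    lam  : Ty → Tm → Tm
    app  : Tm → Tm → Tm
    mu   : Ty → Cmd → Tm
    zro  : Tm
    S    : Tm → Tm
    nrec : Ty → Tm → Tm → Tm → Tm

  data Cmd : Set where
    named : ℕ → Tm → Cmd

num : ℕ → Tm
num zero    = zro
num (suc n) = S (num n)

lift : (ℕ → ℕ) → ℕ → ℕ
lift ρ zero    = zero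
lift ρ (suc i) = suc (ρ i)

mutual
  renλ : (ℕ → ℕ) → Tm → Tm
  renλ ρ (var x)        = var (ρ x)
  renλ ρ (lam A t)      = lam A (renλ (lift ρ) t)
  renλ ρ (app t s)      = app (renλ ρ t) (renλ ρ s)
  renλ ρ (mu A c)       = mu A (renλC ρ c)
  renλ ρ zro            = zro
  renλ ρ (S t)          = S (renλ ρ t)
  renλ ρ (nrec A r s t) = nrec A (renλ ρ r) (renλ ρ s) (renλ ρ t)

  renλC : (ℕ → ℕ) → Cmd → Cmd
  renλC ρ (named α t) = named α (renλ ρ t)

mutual
  renμ : (ℕ → ℕ) → Tm → Tm
  renμ ρ (var x)        = var x
  renμ ρ (lam A t)      = lam A (renμ ρ t)
  renμ ρ (app t s)      = app (renμ ρ t) (renμ ρ s)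
  renμ ρ (mu A c)       = mu A (renμC (lift ρ) c)
  renμ ρ zro            = zro
  renμ ρ (S t)          = S (renμ ρ t)
  renμ ρ (nrec A r s t) = nrec A (renμ ρ r) (renμ ρ s) (renμ ρ t)

  renμC : (ℕ → ℕ) → Cmd → Cmd
  renμC ρ (named α t) = named (ρ α) (renμ ρ t)

exts : (ℕ → Tm) → ℕ → Tm
exts σ zero    = var zero
exts σ (suc i) = renλ suc (σ i)

mutual
  sub : (ℕ → Tm) → Tm → Tm
  sub σ (var x)        = σ x
  sub σ (lam A t)      = lam A (sub (exts σ) t)
  sub σ (app t s)      = app (sub σ t) (sub σ s)
  sub σ (mu A c)       = mu A (subC (λ i → renμ suc (σ i)) c)
  sub σ zro            = zro
  sub σ (S t)          = S (sub σ t)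
  sub σ (nrec A r s t) = nrec A (sub σ r) (sub σ s) (sub σ t)

  subC : (ℕ → Tm) → Cmd → Cmd
  subC σ (named α t) = named α (sub σ t)

single : Tm → ℕ → Tm
single r zero    = r
single r (suc i) = var i

_[0:=_] : Tm → Tm → Tm
t [0:= r ] = sub (single r) t

data ECtx : Set where
  hole  : ECtx
  appE  : ECtx → Tm → ECtx
  SE    : ECtx → ECtx
  nrecE : Ty → Tm → Tm → ECtx → ECtx

plug : ECtx → Tm → Tm
plug hole            q = q
plug (appE E t)      q = app (plug E q) t
plug (SE E)          q = S (plug E q)
plug (nrecE A r s E) q = nrec A r s (plug E q)

renλE : (ℕ → ℕ) → ECtx → ECtx
renλE ρ hole            = hole
renλE ρ (appE E t)      = appE (renλE ρ E) (renλ ρ t)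
renλE ρ (SE E)          = SE (renλE ρ E)
renλE ρ (nrecE A r s E) = nrecE A (renλ ρ r) (renλ ρ s) (renλE ρ E)

renμE : (ℕ → ℕ) → ECtx → ECtx
renμE ρ hole            = hole
renμE ρ (appE E t)      = appE (renμE ρ E) (renμ ρ t)
renμE ρ (SE E)          = SE (renμE ρ E)
renμE ρ (nrecE A r s E) = nrecE A (renμ ρ r) (renμ ρ s) (renμE ρ E)

-- Structural substitution  t[α:=α E]  (here β = α, the only case used):
-- every subcommand [α]q becomes [α] E[q[α:=α E]], capture-avoiding.

mutual
  ssub : ℕ → ECtx → Tm → Tm
  ssub k E (var x)        = var x
  ssub k E (lam A t)      = lam A (ssub k (renλE suc E) t)
  ssub k E (app t s)      = app (ssub k E t) (ssub k E s)
  ssub k E (mu A c)       = mu A (ssubC (suc k) (renμE suc E) c)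
  ssub k E zro            = zro
  ssub k E (S t)          = S (ssub k E t)
  ssub k E (nrec A r s t) = nrec A (ssub k E r) (ssub k E s) (ssub k E t)

  ssubC : ℕ → ECtx → Cmd → Cmd
  ssubC k E (named β q) with β ≟ k
  ... | yes _ = named β (plug E (ssub k E q))
  ... | no  _ = named β (ssub k E q)

infix 4 _⟶_ _⟶C_

mutual
  data _⟶_ : Tm → Tm → Set where
    β       : ∀ {A t r} → app (lam A t) r ⟶ t [0:= r ]
    μS      : ∀ {A c} → S (mu A c) ⟶ mu A (ssubC 0 (SE hole) c)
    μapp    : ∀ {A c s} → app (mu A c) s ⟶ mu A (ssubC 0 (appE hole (renμ suc s)) c)
    nrec0   : ∀ {A r s} → nrec A r s zro ⟶ r
    nrecS   : ∀ {A r s n} → nrec A r s (S (num n)) ⟶ app (app s (num n)) (nrec A r s (num n))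
    nrecμ   : ∀ {A B r s c} →
              nrec A r s (mu B c) ⟶ mu B (ssubC 0 (nrecE A (renμ suc r) (renμ suc s) hole) c)
    ξlam    : ∀ {A t t'} → t ⟶ t' → lam A t ⟶ lam A t'
    ξappl   : ∀ {t t' s} → t ⟶ t' → app t s ⟶ app t' s
    ξappr   : ∀ {t s s'} → s ⟶ s' → app t s ⟶ app t s'
    ξmu     : ∀ {A c c'} → c ⟶C c' → mu A c ⟶ mu A c'
    ξS      : ∀ {t t'} → t ⟶ t' → S t ⟶ S t'
    ξnrec₁  : ∀ {A r r' s t} → r ⟶ r' → nrec A r s t ⟶ nrec A r' s t
    ξnrec₂  : ∀ {A r s s' t} → s ⟶ s' → nrec A r s t ⟶ nrec A r s' t
    ξnrec₃  : ∀ {A r s t t'} → t ⟶ t' → nrec A r s t ⟶ nrec A r s t'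

  data _⟶C_ : Cmd → Cmd → Set where
    ξnamed  : ∀ {α t t'} → t ⟶ t' → named α t ⟶C named α t'

data SN : Tm → Set where
  sn : ∀ {t} → (∀ {t'} → t ⟶ t' → SN t') → SN t

Ctx : Set
Ctx = List Ty

data _∋_∶_ : Ctx → ℕ → Ty → Set where
  here  : ∀ {Γ A} → (A ∷ Γ) ∋ zero ∶ A
  there : ∀ {Γ A B i} → Γ ∋ i ∶ A → (B ∷ Γ) ∋ suc i ∶ A

infix 3 _︔_⊢_∶_ _︔_⊢C_
infix 4 _∋_∶_

mutual
  data _︔_⊢_∶_ : Ctx → Ctx → Tm → Ty → Set where
    ⊢var  : ∀ {Γ Δ x A} → Γ ∋ x ∶ A → Γ ︔ Δ ⊢ var x ∶ A
    ⊢lam  : ∀ {Γ Δ A B t} → (A ∷ Γ) ︔ Δ ⊢ t ∶ B → Γ ︔ Δ ⊢ lam A t ∶ A ⇒ B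
    ⊢app  : ∀ {Γ Δ A B t s} → Γ ︔ Δ ⊢ t ∶ A ⇒ B → Γ ︔ Δ ⊢ s ∶ A → Γ ︔ Δ ⊢ app t s ∶ B
    ⊢zro  : ∀ {Γ Δ} → Γ ︔ Δ ⊢ zro ∶ Nat
    ⊢S    : ∀ {Γ Δ t} → Γ ︔ Δ ⊢ t ∶ Nat → Γ ︔ Δ ⊢ S t ∶ Nat
    ⊢nrec : ∀ {Γ Δ A r s t} → Γ ︔ Δ ⊢ r ∶ A → Γ ︔ Δ ⊢ s ∶ Nat ⇒ A ⇒ A →
            Γ ︔ Δ ⊢ t ∶ Nat → Γ ︔ Δ ⊢ nrec A r s t ∶ A
    ⊢mu   : ∀ {Γ Δ A c} → Γ ︔ (A ∷ Δ) ⊢C c → Γ ︔ Δ ⊢ mu A c ∶ A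

  data _︔_⊢C_ : Ctx → Ctx → Cmd → Set where
    ⊢named : ∀ {Γ Δ α A t} → Γ ︔ Δ ⊢ t ∶ A → Δ ∋ α ∶ A → Γ ︔ Δ ⊢C named α t

module Submission where

-- Strong normalisation of λμT by reducibility candidates defined by
-- orthogonality (in the style of Parigot and Krivine).
--
-- A type A is interpreted by a set 𝒦 A of evaluation contexts and by the set
-- ⟦ A ⟧ of terms t such that E[t] is SN for every E ∈ 𝒦 A (and every renaming
-- of the μ-names of t).  𝒦 ℕ contains the contexts sending numerals and SN
-- neutral terms to SN terms; 𝒦 (A ⇒ B) contains the contexts E[□ u] with
-- u ∈ ⟦ A ⟧ and E ∈ 𝒦 B.
--
-- The theorem is adequacy at the identity instance.

open import Defs
open import Data.Nat using (ℕ; zero; suc; _≟_)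
open import Data.Nat.Properties using (suc-injective)
open import Data.Product using (Σ; _×_; _,_; proj₁; proj₂)
open import Data.Sum using (_⊎_; inj₁; inj₂)
open import Data.List using (_∷_)
open import Data.Empty using (⊥-elim)
open import Relation.Nullary using (yes; no; ¬_)
open import Relation.Binary.PropositionalEquality
open import Relation.Binary.Construct.Closure.ReflexiveTransitive using (Star; ε; _◅_; _◅◅_; gmap)

cong₃ : ∀ {A B C D : Set} (f : A → B → C → D) {a a' b b' c c'} →
        a ≡ a' → b ≡ b' → c ≡ c' → f a b c ≡ f a' b' c'
cong₃ f refl refl refl = refl

infixr 9 _∘E_
_∘E_ : ECtx → ECtx → ECtx
hole            ∘E F = F
appE E t        ∘E F = appE (E ∘E F) t
SE E            ∘E F = SE (E ∘E F)
nrecE A r s E   ∘E F = nrecE A r s (E ∘E F)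

-- Number of frames of a context; the μ-lemma is proved by induction on it.
depth : ECtx → ℕ
depth hole            = zero
depth (appE E t)      = suc (depth E)
depth (SE E)          = suc (depth E)
depth (nrecE A r s E) = suc (depth E)

plug-∘E : ∀ E F q → plug (E ∘E F) q ≡ plug E (plug F q)
plug-∘E hole            F q = refl
plug-∘E (appE E t)      F q = cong (λ z → app z t) (plug-∘E E F q)
plug-∘E (SE E)          F q = cong S (plug-∘E E F q)
plug-∘E (nrecE A r s E) F q = cong (nrec A r s) (plug-∘E E F q)

∘E-hole : ∀ E → E ∘E hole ≡ E
∘E-hole hole            = refl
∘E-hole (appE E t)      = cong (λ z → appE z t) (∘E-hole E)
∘E-hole (SE E)          = cong SE (∘E-hole E)
∘E-hole (nrecE A r s E) = cong (nrecE A r s) (∘E-hole E)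

-- Renamings.  Lemmas about renamings take pointwise equations between
-- renamings as hypotheses, so that they apply under any number of lifts.

lift-fuse : ∀ {ρ₁ ρ₂ ρ₃ : ℕ → ℕ} → (∀ i → ρ₃ i ≡ ρ₁ (ρ₂ i)) →
            ∀ i → lift ρ₃ i ≡ lift ρ₁ (lift ρ₂ i)
lift-fuse h zero    = refl
lift-fuse h (suc i) = cong suc (h i)

lift-id : ∀ {ρ : ℕ → ℕ} → (∀ i → ρ i ≡ i) → ∀ i → lift ρ i ≡ i
lift-id h zero    = refl
lift-id h (suc i) = cong suc (h i)

mutual
  renμ-fuse : ∀ {ρ₁ ρ₂ ρ₃} → (∀ i → ρ₃ i ≡ ρ₁ (ρ₂ i)) → ∀ t → renμ ρ₁ (renμ ρ₂ t) ≡ renμ ρ₃ t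
  renμ-fuse h (var x)        = refl
  renμ-fuse h (lam A t)      = cong (lam A) (renμ-fuse h t)
  renμ-fuse h (app t s)      = cong₂ app (renμ-fuse h t) (renμ-fuse h s)
  renμ-fuse h (mu A c)       = cong (mu A) (renμC-fuse (lift-fuse h) c)
  renμ-fuse h zro            = refl
  renμ-fuse h (S t)          = cong S (renμ-fuse h t)
  renμ-fuse h (nrec A r s t) = cong₃ (nrec A) (renμ-fuse h r) (renμ-fuse h s) (renμ-fuse h t)

  renμC-fuse : ∀ {ρ₁ ρ₂ ρ₃} → (∀ i → ρ₃ i ≡ ρ₁ (ρ₂ i)) → ∀ c → renμC ρ₁ (renμC ρ₂ c) ≡ renμC ρ₃ c
  renμC-fuse h (named α t) = cong₂ named (sym (h α)) (renμ-fuse h t)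

mutual
  renλ-fuse : ∀ {ρ₁ ρ₂ ρ₃} → (∀ i → ρ₃ i ≡ ρ₁ (ρ₂ i)) → ∀ t → renλ ρ₁ (renλ ρ₂ t) ≡ renλ ρ₃ t
  renλ-fuse h (var x)        = cong var (sym (h x))
  renλ-fuse h (lam A t)      = cong (lam A) (renλ-fuse (lift-fuse h) t)
  renλ-fuse h (app t s)      = cong₂ app (renλ-fuse h t) (renλ-fuse h s)
  renλ-fuse h (mu A c)       = cong (mu A) (renλC-fuse h c)
  renλ-fuse h zro            = refl
  renλ-fuse h (S t)          = cong S (renλ-fuse h t)
  renλ-fuse h (nrec A r s t) = cong₃ (nrec A) (renλ-fuse h r) (renλ-fuse h s) (renλ-fuse h t)

  renλC-fuse : ∀ {ρ₁ ρ₂ ρ₃} → (∀ i → ρ₃ i ≡ ρ₁ (ρ₂ i)) → ∀ c → renλC ρ₁ (renλC ρ₂ c) ≡ renλC ρ₃ c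
  renλC-fuse h (named α t) = cong (named α) (renλ-fuse h t)

mutual
  renμ-id : ∀ {ρ} → (∀ i → ρ i ≡ i) → ∀ t → renμ ρ t ≡ t
  renμ-id h (var x)        = refl
  renμ-id h (lam A t)      = cong (lam A) (renμ-id h t)
  renμ-id h (app t s)      = cong₂ app (renμ-id h t) (renμ-id h s)
  renμ-id h (mu A c)       = cong (mu A) (renμC-id (lift-id h) c)
  renμ-id h zro            = refl
  renμ-id h (S t)          = cong S (renμ-id h t)
  renμ-id h (nrec A r s t) = cong₃ (nrec A) (renμ-id h r) (renμ-id h s) (renμ-id h t)

  renμC-id : ∀ {ρ} → (∀ i → ρ i ≡ i) → ∀ c → renμC ρ c ≡ c
  renμC-id h (named α t) = cong₂ named (h α) (renμ-id h t)

mutual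
  renμ-renλ : ∀ ρ ρ' t → renμ ρ (renλ ρ' t) ≡ renλ ρ' (renμ ρ t)
  renμ-renλ ρ ρ' (var x)        = refl
  renμ-renλ ρ ρ' (lam A t)      = cong (lam A) (renμ-renλ ρ (lift ρ') t)
  renμ-renλ ρ ρ' (app t s)      = cong₂ app (renμ-renλ ρ ρ' t) (renμ-renλ ρ ρ' s)
  renμ-renλ ρ ρ' (mu A c)       = cong (mu A) (renμC-renλC (lift ρ) ρ' c)
  renμ-renλ ρ ρ' zro            = refl
  renμ-renλ ρ ρ' (S t)          = cong S (renμ-renλ ρ ρ' t)
  renμ-renλ ρ ρ' (nrec A r s t) = cong₃ (nrec A) (renμ-renλ ρ ρ' r) (renμ-renλ ρ ρ' s) (renμ-renλ ρ ρ' t)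

  renμC-renλC : ∀ ρ ρ' c → renμC ρ (renλC ρ' c) ≡ renλC ρ' (renμC ρ c)
  renμC-renλC ρ ρ' (named α t) = cong (named (ρ α)) (renμ-renλ ρ ρ' t)

renμE-fuse : ∀ {ρ₁ ρ₂ ρ₃} → (∀ i → ρ₃ i ≡ ρ₁ (ρ₂ i)) → ∀ E → renμE ρ₁ (renμE ρ₂ E) ≡ renμE ρ₃ E
renμE-fuse h hole            = refl
renμE-fuse h (appE E t)      = cong₂ appE (renμE-fuse h E) (renμ-fuse h t)
renμE-fuse h (SE E)          = cong SE (renμE-fuse h E)
renμE-fuse h (nrecE A r s E) = cong₃ (nrecE A) (renμ-fuse h r) (renμ-fuse h s) (renμE-fuse h E)

renλE-fuse : ∀ {ρ₁ ρ₂ ρ₃} → (∀ i → ρ₃ i ≡ ρ₁ (ρ₂ i)) → ∀ E → renλE ρ₁ (renλE ρ₂ E) ≡ renλE ρ₃ E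
renλE-fuse h hole            = refl
renλE-fuse h (appE E t)      = cong₂ appE (renλE-fuse h E) (renλ-fuse h t)
renλE-fuse h (SE E)          = cong SE (renλE-fuse h E)
renλE-fuse h (nrecE A r s E) = cong₃ (nrecE A) (renλ-fuse h r) (renλ-fuse h s) (renλE-fuse h E)

renμE-id : ∀ {ρ} → (∀ i → ρ i ≡ i) → ∀ E → renμE ρ E ≡ E
renμE-id h hole            = refl
renμE-id h (appE E t)      = cong₂ appE (renμE-id h E) (renμ-id h t)
renμE-id h (SE E)          = cong SE (renμE-id h E)
renμE-id h (nrecE A r s E) = cong₃ (nrecE A) (renμ-id h r) (renμ-id h s) (renμE-id h E)

renμE-renλE : ∀ ρ ρ' E → renμE ρ (renλE ρ' E) ≡ renλE ρ' (renμE ρ E)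
renμE-renλE ρ ρ' hole            = refl
renμE-renλE ρ ρ' (appE E t)      = cong₂ appE (renμE-renλE ρ ρ' E) (renμ-renλ ρ ρ' t)
renμE-renλE ρ ρ' (SE E)          = cong SE (renμE-renλE ρ ρ' E)
renμE-renλE ρ ρ' (nrecE A r s E) =
  cong₃ (nrecE A) (renμ-renλ ρ ρ' r) (renμ-renλ ρ ρ' s) (renμE-renλE ρ ρ' E)

renλ-weaken : ∀ ρ t → renλ suc (renλ ρ t) ≡ renλ (lift ρ) (renλ suc t)
renλ-weaken ρ t = trans (renλ-fuse (λ _ → refl) t) (sym (renλ-fuse (λ _ → refl) t))

renμ-weaken : ∀ ρ t → renμ suc (renμ ρ t) ≡ renμ (lift ρ) (renμ suc t)
renμ-weaken ρ t = trans (renμ-fuse (λ _ → refl) t) (sym (renμ-fuse (λ _ → refl) t))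

renλE-weaken : ∀ ρ E → renλE suc (renλE ρ E) ≡ renλE (lift ρ) (renλE suc E)
renλE-weaken ρ E = trans (renλE-fuse (λ _ → refl) E) (sym (renλE-fuse (λ _ → refl) E))

renμE-weaken : ∀ ρ E → renμE suc (renμE ρ E) ≡ renμE (lift ρ) (renμE suc E)
renμE-weaken ρ E = trans (renμE-fuse (λ _ → refl) E) (sym (renμE-fuse (λ _ → refl) E))

subE : (ℕ → Tm) → ECtx → ECtx
subE σ hole            = hole
subE σ (appE E t)      = appE (subE σ E) (sub σ t)
subE σ (SE E)          = SE (subE σ E)
subE σ (nrecE A r s E) = nrecE A (sub σ r) (sub σ s) (subE σ E)

ssubE : ℕ → ECtx → ECtx → ECtx
ssubE k G hole            = hole
ssubE k G (appE E t)      = appE (ssubE k G E) (ssub k G t)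
ssubE k G (SE E)          = SE (ssubE k G E)
ssubE k G (nrecE A r s E) = nrecE A (ssub k G r) (ssub k G s) (ssubE k G E)

plug-renλ : ∀ ρ E q → renλ ρ (plug E q) ≡ plug (renλE ρ E) (renλ ρ q)
plug-renλ ρ hole            q = refl
plug-renλ ρ (appE E t)      q = cong (λ z → app z (renλ ρ t)) (plug-renλ ρ E q)
plug-renλ ρ (SE E)          q = cong S (plug-renλ ρ E q)
plug-renλ ρ (nrecE A r s E) q = cong (nrec A (renλ ρ r) (renλ ρ s)) (plug-renλ ρ E q)

plug-renμ : ∀ ρ E q → renμ ρ (plug E q) ≡ plug (renμE ρ E) (renμ ρ q)
plug-renμ ρ hole            q = refl
plug-renμ ρ (appE E t)      q = cong (λ z → app z (renμ ρ t)) (plug-renμ ρ E q)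
plug-renμ ρ (SE E)          q = cong S (plug-renμ ρ E q)
plug-renμ ρ (nrecE A r s E) q = cong (nrec A (renμ ρ r) (renμ ρ s)) (plug-renμ ρ E q)

plug-sub : ∀ σ E q → sub σ (plug E q) ≡ plug (subE σ E) (sub σ q)
plug-sub σ hole            q = refl
plug-sub σ (appE E t)      q = cong (λ z → app z (sub σ t)) (plug-sub σ E q)
plug-sub σ (SE E)          q = cong S (plug-sub σ E q)
plug-sub σ (nrecE A r s E) q = cong (nrec A (sub σ r) (sub σ s)) (plug-sub σ E q)

plug-ssub : ∀ k G E q → ssub k G (plug E q) ≡ plug (ssubE k G E) (ssub k G q)
plug-ssub k G hole            q = refl
plug-ssub k G (appE E t)      q = cong (λ z → app z (ssub k G t)) (plug-ssub k G E q)
plug-ssub k G (SE E)          q = cong S (plug-ssub k G E q)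
plug-ssub k G (nrecE A r s E) q = cong (nrec A (ssub k G r) (ssub k G s)) (plug-ssub k G E q)

∘E-renλ : ∀ ρ E F → renλE ρ (E ∘E F) ≡ renλE ρ E ∘E renλE ρ F
∘E-renλ ρ hole            F = refl
∘E-renλ ρ (appE E t)      F = cong (λ z → appE z (renλ ρ t)) (∘E-renλ ρ E F)
∘E-renλ ρ (SE E)          F = cong SE (∘E-renλ ρ E F)
∘E-renλ ρ (nrecE A r s E) F = cong (nrecE A (renλ ρ r) (renλ ρ s)) (∘E-renλ ρ E F)

∘E-renμ : ∀ ρ E F → renμE ρ (E ∘E F) ≡ renμE ρ E ∘E renμE ρ F
∘E-renμ ρ hole            F = refl
∘E-renμ ρ (appE E t)      F = cong (λ z → appE z (renμ ρ t)) (∘E-renμ ρ E F)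
∘E-renμ ρ (SE E)          F = cong SE (∘E-renμ ρ E F)
∘E-renμ ρ (nrecE A r s E) F = cong (nrecE A (renμ ρ r) (renμ ρ s)) (∘E-renμ ρ E F)

num-renλ : ∀ ρ n → renλ ρ (num n) ≡ num n
num-renλ ρ zero    = refl
num-renλ ρ (suc n) = cong S (num-renλ ρ n)

num-renμ : ∀ ρ n → renμ ρ (num n) ≡ num n
num-renμ ρ zero    = refl
num-renμ ρ (suc n) = cong S (num-renμ ρ n)

num-sub : ∀ σ n → sub σ (num n) ≡ num n
num-sub σ zero    = refl
num-sub σ (suc n) = cong S (num-sub σ n)

num-ssub : ∀ k G n → ssub k G (num n) ≡ num n
num-ssub k G zero    = refl
num-ssub k G (suc n) = cong S (num-ssub k G n)

mutual
  sub-renλ : ∀ {σ σ' ρ} → (∀ i → σ' i ≡ σ (ρ i)) → ∀ t → sub σ (renλ ρ t) ≡ sub σ' t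
  sub-renλ h (var x)        = sym (h x)
  sub-renλ {σ} {σ'} {ρ} h (lam A t) = cong (lam A) (sub-renλ h' t)
    where h' : ∀ i → exts σ' i ≡ exts σ (lift ρ i)
          h' zero    = refl
          h' (suc i) = cong (renλ suc) (h i)
  sub-renλ h (app t s)      = cong₂ app (sub-renλ h t) (sub-renλ h s)
  sub-renλ h (mu A c)       = cong (mu A) (subC-renλC (λ i → cong (renμ suc) (h i)) c)
  sub-renλ h zro            = refl
  sub-renλ h (S t)          = cong S (sub-renλ h t)
  sub-renλ h (nrec A r s t) = cong₃ (nrec A) (sub-renλ h r) (sub-renλ h s) (sub-renλ h t)

  subC-renλC : ∀ {σ σ' ρ} → (∀ i → σ' i ≡ σ (ρ i)) → ∀ c → subC σ (renλC ρ c) ≡ subC σ' c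
  subC-renλC h (named α t) = cong (named α) (sub-renλ h t)

mutual
  renλ-sub : ∀ {σ σ' ρ} → (∀ i → σ' i ≡ renλ ρ (σ i)) → ∀ t → renλ ρ (sub σ t) ≡ sub σ' t
  renλ-sub h (var x)        = sym (h x)
  renλ-sub {σ} {σ'} {ρ} h (lam A t) = cong (lam A) (renλ-sub h' t)
    where h' : ∀ i → exts σ' i ≡ renλ (lift ρ) (exts σ i)
          h' zero    = refl
          h' (suc i) = trans (cong (renλ suc) (h i)) (renλ-weaken ρ (σ i))
  renλ-sub h (app t s)      = cong₂ app (renλ-sub h t) (renλ-sub h s)
  renλ-sub {σ} {σ'} {ρ} h (mu A c) =
    cong (mu A) (renλC-subC (λ i → trans (cong (renμ suc) (h i)) (renμ-renλ suc ρ (σ i))) c)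
  renλ-sub h zro            = refl
  renλ-sub h (S t)          = cong S (renλ-sub h t)
  renλ-sub h (nrec A r s t) = cong₃ (nrec A) (renλ-sub h r) (renλ-sub h s) (renλ-sub h t)

  renλC-subC : ∀ {σ σ' ρ} → (∀ i → σ' i ≡ renλ ρ (σ i)) → ∀ c → renλC ρ (subC σ c) ≡ subC σ' c
  renλC-subC h (named α t) = cong (named α) (renλ-sub h t)

mutual
  renμ-sub : ∀ {σ σ' ρ} → (∀ i → σ' i ≡ renμ ρ (σ i)) → ∀ t → renμ ρ (sub σ t) ≡ sub σ' (renμ ρ t)
  renμ-sub h (var x)        = sym (h x)
  renμ-sub {σ} {σ'} {ρ} h (lam A t) = cong (lam A) (renμ-sub h' t)
    where h' : ∀ i → exts σ' i ≡ renμ ρ (exts σ i)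
          h' zero    = refl
          h' (suc i) = trans (cong (renλ suc) (h i)) (sym (renμ-renλ ρ suc (σ i)))
  renμ-sub h (app t s)      = cong₂ app (renμ-sub h t) (renμ-sub h s)
  renμ-sub {σ} {σ'} {ρ} h (mu A c) =
    cong (mu A) (renμC-subC (λ i → trans (cong (renμ suc) (h i)) (renμ-weaken ρ (σ i))) c)
  renμ-sub h zro            = refl
  renμ-sub h (S t)          = cong S (renμ-sub h t)
  renμ-sub h (nrec A r s t) = cong₃ (nrec A) (renμ-sub h r) (renμ-sub h s) (renμ-sub h t)

  renμC-subC : ∀ {σ σ' ρ} → (∀ i → σ' i ≡ renμ ρ (σ i)) → ∀ c → renμC ρ (subC σ c) ≡ subC σ' (renμC ρ c)
  renμC-subC h (named α t) = cong (named _) (renμ-sub h t)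

mutual
  sub-sub : ∀ {σ τ σ₃} → (∀ i → σ₃ i ≡ sub τ (σ i)) → ∀ t → sub τ (sub σ t) ≡ sub σ₃ t
  sub-sub h (var x)        = sym (h x)
  sub-sub {σ} {τ} {σ₃} h (lam A t) = cong (lam A) (sub-sub h' t)
    where h' : ∀ i → exts σ₃ i ≡ sub (exts τ) (exts σ i)
          h' zero    = refl
          h' (suc i) = trans (cong (renλ suc) (h i))
                             (trans (renλ-sub (λ _ → refl) (σ i)) (sym (sub-renλ (λ _ → refl) (σ i))))
  sub-sub h (app t s)      = cong₂ app (sub-sub h t) (sub-sub h s)
  sub-sub {σ} {τ} {σ₃} h (mu A c) =
    cong (mu A) (subC-subC (λ i → trans (cong (renμ suc) (h i)) (renμ-sub (λ _ → refl) (σ i))) c)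
  sub-sub h zro            = refl
  sub-sub h (S t)          = cong S (sub-sub h t)
  sub-sub h (nrec A r s t) = cong₃ (nrec A) (sub-sub h r) (sub-sub h s) (sub-sub h t)

  subC-subC : ∀ {σ τ σ₃} → (∀ i → σ₃ i ≡ sub τ (σ i)) → ∀ c → subC τ (subC σ c) ≡ subC σ₃ c
  subC-subC h (named α t) = cong (named α) (sub-sub h t)

mutual
  sub-id : ∀ {σ} → (∀ i → σ i ≡ var i) → ∀ t → sub σ t ≡ t
  sub-id h (var x)        = h x
  sub-id {σ} h (lam A t)  = cong (lam A) (sub-id h' t)
    where h' : ∀ i → exts σ i ≡ var i
          h' zero    = refl
          h' (suc i) = cong (renλ suc) (h i)
  sub-id h (app t s)      = cong₂ app (sub-id h t) (sub-id h s)
  sub-id h (mu A c)       = cong (mu A) (subC-id (λ i → cong (renμ suc) (h i)) c)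
  sub-id h zro            = refl
  sub-id h (S t)          = cong S (sub-id h t)
  sub-id h (nrec A r s t) = cong₃ (nrec A) (sub-id h r) (sub-id h s) (sub-id h t)

  subC-id : ∀ {σ} → (∀ i → σ i ≡ var i) → ∀ c → subC σ c ≡ c
  subC-id h (named α t) = cong (named α) (sub-id h t)

subE-renλE : ∀ {σ σ' ρ} → (∀ i → σ' i ≡ σ (ρ i)) → ∀ E → subE σ (renλE ρ E) ≡ subE σ' E
subE-renλE h hole            = refl
subE-renλE h (appE E t)      = cong₂ appE (subE-renλE h E) (sub-renλ h t)
subE-renλE h (SE E)          = cong SE (subE-renλE h E)
subE-renλE h (nrecE A r s E) = cong₃ (nrecE A) (sub-renλ h r) (sub-renλ h s) (subE-renλE h E)

renλE-subE : ∀ {σ σ' ρ} → (∀ i → σ' i ≡ renλ ρ (σ i)) → ∀ E → renλE ρ (subE σ E) ≡ subE σ' E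
renλE-subE h hole            = refl
renλE-subE h (appE E t)      = cong₂ appE (renλE-subE h E) (renλ-sub h t)
renλE-subE h (SE E)          = cong SE (renλE-subE h E)
renλE-subE h (nrecE A r s E) = cong₃ (nrecE A) (renλ-sub h r) (renλ-sub h s) (renλE-subE h E)

renμE-subE : ∀ {σ σ' ρ} → (∀ i → σ' i ≡ renμ ρ (σ i)) → ∀ E → renμE ρ (subE σ E) ≡ subE σ' (renμE ρ E)
renμE-subE h hole            = refl
renμE-subE h (appE E t)      = cong₂ appE (renμE-subE h E) (renμ-sub h t)
renμE-subE h (SE E)          = cong SE (renμE-subE h E)
renμE-subE h (nrecE A r s E) = cong₃ (nrecE A) (renμ-sub h r) (renμ-sub h s) (renμE-subE h E)

subE-id : ∀ {σ} → (∀ i → σ i ≡ var i) → ∀ E → subE σ E ≡ E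
subE-id h hole            = refl
subE-id h (appE E t)      = cong₂ appE (subE-id h E) (sub-id h t)
subE-id h (SE E)          = cong SE (subE-id h E)
subE-id h (nrecE A r s E) = cong₃ (nrecE A) (sub-id h r) (sub-id h s) (subE-id h E)

single-weaken : ∀ u t → renλ suc t [0:= u ] ≡ t
single-weaken u t = trans (sub-renλ (λ _ → refl) t) (sub-id (λ _ → refl) t)

single-weakenE : ∀ u E → subE (single u) (renλE suc E) ≡ E
single-weakenE u E = trans (subE-renλE (λ _ → refl) E) (subE-id (λ _ → refl) E)

sub-β : ∀ σ t r → sub σ (t [0:= r ]) ≡ sub (exts σ) t [0:= sub σ r ]
sub-β σ t r = trans (sub-sub (λ _ → refl) t) (sym (sub-sub h t))
  where h : ∀ i → sub σ (single r i) ≡ sub (single (sub σ r)) (exts σ i)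
        h zero    = refl
        h (suc i) = sym (single-weaken (sub σ r) (σ i))

renλ-β : ∀ ρ t r → renλ ρ (t [0:= r ]) ≡ renλ (lift ρ) t [0:= renλ ρ r ]
renλ-β ρ t r = trans (renλ-sub (λ _ → refl) t) (sym (sub-renλ h t))
  where h : ∀ i → renλ ρ (single r i) ≡ single (renλ ρ r) (lift ρ i)
        h zero    = refl
        h (suc i) = refl

renμ-β : ∀ ρ t r → renμ ρ (t [0:= r ]) ≡ renμ ρ t [0:= renμ ρ r ]
renμ-β ρ t r = renμ-sub h t
  where h : ∀ i → single (renμ ρ r) i ≡ renμ ρ (single r i)
        h zero    = refl
        h (suc i) = refl

ssubC-hit : ∀ {k G b q} → b ≡ k → ssubC k G (named b q) ≡ named b (plug G (ssub k G q))
ssubC-hit {k} {G} {b} e with b ≟ k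
... | yes _  = refl
... | no b≢k = ⊥-elim (b≢k e)

ssubC-miss : ∀ {k G b q} → ¬ b ≡ k → ssubC k G (named b q) ≡ named b (ssub k G q)
ssubC-miss {k} {G} {b} b≢k with b ≟ k
... | yes e = ⊥-elim (b≢k e)
... | no _  = refl

mutual
  renλ-ssub : ∀ ρ k G t → renλ ρ (ssub k G t) ≡ ssub k (renλE ρ G) (renλ ρ t)
  renλ-ssub ρ k G (var x)   = refl
  renλ-ssub ρ k G (lam A t) = cong (lam A) (trans (renλ-ssub (lift ρ) k (renλE suc G) t)
    (cong (λ z → ssub k z (renλ (lift ρ) t)) (sym (renλE-weaken ρ G))))
  renλ-ssub ρ k G (app t s) = cong₂ app (renλ-ssub ρ k G t) (renλ-ssub ρ k G s)
  renλ-ssub ρ k G (mu A c)  = cong (mu A) (trans (renλC-ssubC ρ (suc k) (renμE suc G) c)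
    (cong (λ z → ssubC (suc k) z (renλC ρ c)) (sym (renμE-renλE suc ρ G))))
  renλ-ssub ρ k G zro       = refl
  renλ-ssub ρ k G (S t)     = cong S (renλ-ssub ρ k G t)
  renλ-ssub ρ k G (nrec A r s t) =
    cong₃ (nrec A) (renλ-ssub ρ k G r) (renλ-ssub ρ k G s) (renλ-ssub ρ k G t)

  renλC-ssubC : ∀ ρ k G c → renλC ρ (ssubC k G c) ≡ ssubC k (renλE ρ G) (renλC ρ c)
  renλC-ssubC ρ k G (named b q) with b ≟ k
  ... | yes _ = cong (named b) (trans (plug-renλ ρ G _) (cong (plug (renλE ρ G)) (renλ-ssub ρ k G q)))
  ... | no _  = cong (named b) (renλ-ssub ρ k G q)

renλE-ssubE : ∀ ρ k G E → renλE ρ (ssubE k G E) ≡ ssubE k (renλE ρ G) (renλE ρ E)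
renλE-ssubE ρ k G hole            = refl
renλE-ssubE ρ k G (appE E t)      = cong₂ appE (renλE-ssubE ρ k G E) (renλ-ssub ρ k G t)
renλE-ssubE ρ k G (SE E)          = cong SE (renλE-ssubE ρ k G E)
renλE-ssubE ρ k G (nrecE A r s E) =
  cong₃ (nrecE A) (renλ-ssub ρ k G r) (renλ-ssub ρ k G s) (renλE-ssubE ρ k G E)

InjectiveAt : (ℕ → ℕ) → ℕ → Set
InjectiveAt ρ k = ∀ a → ρ a ≡ ρ k → a ≡ k

injectiveAt-lift : ∀ {ρ k} → InjectiveAt ρ k → InjectiveAt (lift ρ) (suc k)
injectiveAt-lift h zero    ()
injectiveAt-lift h (suc a) e = cong suc (h a (suc-injective e))

suc-injectiveAt : ∀ k → InjectiveAt suc k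
suc-injectiveAt k a e = suc-injective e

mutual
  renμ-ssub : ∀ {ρ k} → InjectiveAt ρ k → ∀ G t → renμ ρ (ssub k G t) ≡ ssub (ρ k) (renμE ρ G) (renμ ρ t)
  renμ-ssub h G (var x)   = refl
  renμ-ssub {ρ} {k} h G (lam A t) = cong (lam A) (trans (renμ-ssub h (renλE suc G) t)
    (cong (λ z → ssub (ρ k) z (renμ ρ t)) (renμE-renλE ρ suc G)))
  renμ-ssub h G (app t s) = cong₂ app (renμ-ssub h G t) (renμ-ssub h G s)
  renμ-ssub {ρ} {k} h G (mu A c) = cong (mu A) (trans (renμC-ssubC (injectiveAt-lift h) (renμE suc G) c)
    (cong (λ z → ssubC (suc (ρ k)) z (renμC (lift ρ) c)) (sym (renμE-weaken ρ G))))
  renμ-ssub h G zro       = refl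
  renμ-ssub h G (S t)     = cong S (renμ-ssub h G t)
  renμ-ssub h G (nrec A r s t) = cong₃ (nrec A) (renμ-ssub h G r) (renμ-ssub h G s) (renμ-ssub h G t)

  renμC-ssubC : ∀ {ρ k} → InjectiveAt ρ k → ∀ G c →
                renμC ρ (ssubC k G c) ≡ ssubC (ρ k) (renμE ρ G) (renμC ρ c)
  renμC-ssubC {ρ} {k} h G (named b q) with b ≟ k
  ... | yes e = trans (cong (named (ρ b)) (trans (plug-renμ ρ G _) (cong (plug (renμE ρ G)) (renμ-ssub h G q))))
                      (sym (ssubC-hit (cong ρ e)))
  ... | no b≢k = trans (cong (named (ρ b)) (renμ-ssub h G q)) (sym (ssubC-miss (λ e → b≢k (h b e))))

renμE-ssubE : ∀ {ρ k} → InjectiveAt ρ k → ∀ G E → renμE ρ (ssubE k G E) ≡ ssubE (ρ k) (renμE ρ G) (renμE ρ E)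
renμE-ssubE h G hole            = refl
renμE-ssubE h G (appE E t)      = cong₂ appE (renμE-ssubE h G E) (renμ-ssub h G t)
renμE-ssubE h G (SE E)          = cong SE (renμE-ssubE h G E)
renμE-ssubE h G (nrecE A r s E) = cong₃ (nrecE A) (renμ-ssub h G r) (renμ-ssub h G s) (renμE-ssubE h G E)

Avoids : (ℕ → ℕ) → ℕ → Set
Avoids ρ k = ∀ i → ¬ ρ i ≡ k

avoids-lift : ∀ {ρ k} → Avoids ρ k → Avoids (lift ρ) (suc k)
avoids-lift h zero    ()
avoids-lift h (suc i) e = h i (suc-injective e)

suc-avoids-0 : Avoids suc zero
suc-avoids-0 i ()

mutual
  ssub-fresh : ∀ {ρ k} → Avoids ρ k → ∀ G t → ssub k G (renμ ρ t) ≡ renμ ρ t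
  ssub-fresh h G (var x)        = refl
  ssub-fresh h G (lam A t)      = cong (lam A) (ssub-fresh h (renλE suc G) t)
  ssub-fresh h G (app t s)      = cong₂ app (ssub-fresh h G t) (ssub-fresh h G s)
  ssub-fresh h G (mu A c)       = cong (mu A) (ssubC-fresh (avoids-lift h) (renμE suc G) c)
  ssub-fresh h G zro            = refl
  ssub-fresh h G (S t)          = cong S (ssub-fresh h G t)
  ssub-fresh h G (nrec A r s t) = cong₃ (nrec A) (ssub-fresh h G r) (ssub-fresh h G s) (ssub-fresh h G t)

  ssubC-fresh : ∀ {ρ k} → Avoids ρ k → ∀ G c → ssubC k G (renμC ρ c) ≡ renμC ρ c
  ssubC-fresh h G (named b q) = trans (ssubC-miss (h b)) (cong (named _) (ssub-fresh h G q))

ssubE-fresh : ∀ {ρ k} → Avoids ρ k → ∀ G E → ssubE k G (renμE ρ E) ≡ renμE ρ E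
ssubE-fresh h G hole            = refl
ssubE-fresh h G (appE E t)      = cong₂ appE (ssubE-fresh h G E) (ssub-fresh h G t)
ssubE-fresh h G (SE E)          = cong SE (ssubE-fresh h G E)
ssubE-fresh h G (nrecE A r s E) = cong₃ (nrecE A) (ssub-fresh h G r) (ssub-fresh h G s) (ssubE-fresh h G E)

mutual
  ssub-sub : ∀ {k G G' σ τ} → (∀ x → τ x ≡ ssub k G (σ x)) → subE τ G' ≡ G →
             ∀ t → ssub k G (sub σ t) ≡ sub τ (ssub k G' t)
  ssub-sub h e (var x)   = sym (h x)
  ssub-sub {k} {G} {G'} {σ} {τ} h e (lam A t) = cong (lam A) (ssub-sub h' e' t)
    where h' : ∀ x → exts τ x ≡ ssub k (renλE suc G) (exts σ x)
          h' zero    = refl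
          h' (suc x) = trans (cong (renλ suc) (h x)) (renλ-ssub suc k G (σ x))
          e' : subE (exts τ) (renλE suc G') ≡ renλE suc G
          e' = trans (subE-renλE (λ _ → refl) G') (trans (sym (renλE-subE (λ _ → refl) G')) (cong (renλE suc) e))
  ssub-sub h e (app t s) = cong₂ app (ssub-sub h e t) (ssub-sub h e s)
  ssub-sub {k} {G} {G'} {σ} {τ} h e (mu A c) = cong (mu A) (ssubC-subC h' e' c)
    where h' : ∀ x → renμ suc (τ x) ≡ ssub (suc k) (renμE suc G) (renμ suc (σ x))
          h' x = trans (cong (renμ suc) (h x)) (renμ-ssub (suc-injectiveAt k) G (σ x))
          e' : subE (λ i → renμ suc (τ i)) (renμE suc G') ≡ renμE suc G
          e' = trans (sym (renμE-subE (λ _ → refl) G')) (cong (renμE suc) e)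
  ssub-sub h e zro       = refl
  ssub-sub h e (S t)     = cong S (ssub-sub h e t)
  ssub-sub h e (nrec A r s t) = cong₃ (nrec A) (ssub-sub h e r) (ssub-sub h e s) (ssub-sub h e t)

  ssubC-subC : ∀ {k G G' σ τ} → (∀ x → τ x ≡ ssub k G (σ x)) → subE τ G' ≡ G →
               ∀ c → ssubC k G (subC σ c) ≡ subC τ (ssubC k G' c)
  ssubC-subC {k} {G} {G'} {σ} {τ} h e (named b q) with b ≟ k
  ... | yes _ = cong (named b) (sym (trans (plug-sub τ G' _) (cong₂ plug e (sym (ssub-sub h e q)))))
  ... | no _  = cong (named b) (ssub-sub h e q)

mutual
  ssub-ssub-same : ∀ k G H t → ssub k G (ssub k H t) ≡ ssub k (G ∘E ssubE k G H) t
  ssub-ssub-same k G H (var x)   = refl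
  ssub-ssub-same k G H (lam A t) = cong (lam A) (trans (ssub-ssub-same k (renλE suc G) (renλE suc H) t)
    (cong (λ z → ssub k z t) (sym (trans (∘E-renλ suc G _) (cong (renλE suc G ∘E_) (renλE-ssubE suc k G H))))))
  ssub-ssub-same k G H (app t s) = cong₂ app (ssub-ssub-same k G H t) (ssub-ssub-same k G H s)
  ssub-ssub-same k G H (mu A c)  = cong (mu A) (trans (ssubC-ssubC-same (suc k) (renμE suc G) (renμE suc H) c)
    (cong (λ z → ssubC (suc k) z c)
      (sym (trans (∘E-renμ suc G _) (cong (renμE suc G ∘E_) (renμE-ssubE (suc-injectiveAt k) G H))))))
  ssub-ssub-same k G H zro       = refl
  ssub-ssub-same k G H (S t)     = cong S (ssub-ssub-same k G H t)
  ssub-ssub-same k G H (nrec A r s t) =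
    cong₃ (nrec A) (ssub-ssub-same k G H r) (ssub-ssub-same k G H s) (ssub-ssub-same k G H t)

  ssubC-ssubC-same : ∀ k G H c → ssubC k G (ssubC k H c) ≡ ssubC k (G ∘E ssubE k G H) c
  ssubC-ssubC-same k G H (named b q) with b ≟ k
  ... | yes e = trans (ssubC-hit e) (cong (named b) (begin
          plug G (ssub k G (plug H (ssub k H q)))           ≡⟨ cong (plug G) (plug-ssub k G H _) ⟩
          plug G (plug (ssubE k G H) (ssub k G (ssub k H q))) ≡⟨ sym (plug-∘E G (ssubE k G H) _) ⟩
          plug (G ∘E ssubE k G H) (ssub k G (ssub k H q))   ≡⟨ cong (plug (G ∘E ssubE k G H)) (ssub-ssub-same k G H q) ⟩
          plug (G ∘E ssubE k G H) (ssub k (G ∘E ssubE k G H) q) ∎))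
    where open ≡-Reasoning
  ... | no b≢k = trans (ssubC-miss b≢k) (cong (named b) (ssub-ssub-same k G H q))

-- Structural substitutions at distinct names j ≠ k commute, provided the
-- context G substituted at k does not mention j (G is a renaming of some
-- G₀ by a renaming avoiding j).
mutual
  ssub-ssub-distinct : ∀ {j k} → ¬ j ≡ k → ∀ {ρ G₀ G} → Avoids ρ j → G ≡ renμE ρ G₀ → ∀ H t →
                       ssub k G (ssub j H t) ≡ ssub j (ssubE k G H) (ssub k G t)
  ssub-ssub-distinct j≢k av eq H (var x)   = refl
  ssub-ssub-distinct {j} {k} j≢k {ρ} {G₀} {G} av eq H (lam A t) = cong (lam A) (trans
    (ssub-ssub-distinct j≢k {G₀ = renλE suc G₀} av (trans (cong (renλE suc) eq) (sym (renμE-renλE ρ suc G₀)))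
      (renλE suc H) t)
    (cong (λ z → ssub j z (ssub k (renλE suc G) t)) (sym (renλE-ssubE suc k G H))))
  ssub-ssub-distinct j≢k av eq H (app t s) = cong₂ app (ssub-ssub-distinct j≢k av eq H t) (ssub-ssub-distinct j≢k av eq H s)
  ssub-ssub-distinct {j} {k} j≢k {ρ} {G₀} {G} av eq H (mu A c) = cong (mu A) (trans
    (ssubC-ssubC-distinct (λ e → j≢k (suc-injective e)) {ρ = λ i → suc (ρ i)} {G₀ = G₀}
      (λ i e → av i (suc-injective e)) (trans (cong (renμE suc) eq) (renμE-fuse (λ _ → refl) G₀)) (renμE suc H) c)
    (cong (λ z → ssubC (suc j) z (ssubC (suc k) (renμE suc G) c)) (sym (renμE-ssubE (suc-injectiveAt k) G H))))
  ssub-ssub-distinct j≢k av eq H zro       = refl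
  ssub-ssub-distinct j≢k av eq H (S t)     = cong S (ssub-ssub-distinct j≢k av eq H t)
  ssub-ssub-distinct j≢k av eq H (nrec A r s t) =
    cong₃ (nrec A) (ssub-ssub-distinct j≢k av eq H r) (ssub-ssub-distinct j≢k av eq H s) (ssub-ssub-distinct j≢k av eq H t)

  ssubC-ssubC-distinct : ∀ {j k} → ¬ j ≡ k → ∀ {ρ G₀ G} → Avoids ρ j → G ≡ renμE ρ G₀ → ∀ H c →
                         ssubC k G (ssubC j H c) ≡ ssubC j (ssubE k G H) (ssubC k G c)
  ssubC-ssubC-distinct {j} {k} j≢k {ρ} {G₀} {G} av eq H (named b q) with b ≟ j | b ≟ k
  ... | yes b≡j | yes b≡k = ⊥-elim (j≢k (trans (sym b≡j) b≡k))
  ... | yes b≡j | no b≢k  = trans (ssubC-miss b≢k) (trans (cong (named b) (trans (plug-ssub k G H _)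
          (cong (plug (ssubE k G H)) (ssub-ssub-distinct j≢k av eq H q)))) (sym (ssubC-hit b≡j)))
  ... | no b≢j  | yes b≡k = trans (ssubC-hit b≡k) (trans (cong (named b) (begin
          plug G (ssub k G (ssub j H q))
            ≡⟨ cong (plug G) (ssub-ssub-distinct j≢k av eq H q) ⟩
          plug G (ssub j (ssubE k G H) (ssub k G q))
            ≡⟨ cong (λ z → plug z (ssub j (ssubE k G H) (ssub k G q))) G-fresh ⟩
          plug (ssubE j (ssubE k G H) G) (ssub j (ssubE k G H) (ssub k G q))
            ≡⟨ sym (plug-ssub j (ssubE k G H) G _) ⟩
          ssub j (ssubE k G H) (plug G (ssub k G q)) ∎)) (sym (ssubC-miss b≢j)))
    where open ≡-Reasoning
          G-fresh : G ≡ ssubE j (ssubE k G H) G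
          G-fresh = sym (trans (cong (ssubE j (ssubE k G H)) eq) (trans (ssubE-fresh av _ G₀) (sym eq)))
  ... | no b≢j  | no b≢k  = trans (ssubC-miss b≢k) (trans (cong (named b) (ssub-ssub-distinct j≢k av eq H q))
          (sym (ssubC-miss b≢j)))

-- Simultaneous instantiation  inst σ ρ π:  every λ-variable x becomes σ x,
-- and every command [a]t becomes [ρ a] (π a)[t], i.e. the μ-name a is renamed
-- to ρ a and the context π a is structurally substituted for it.  Under a
-- μ-binder the bound name is left alone (renamed to 0, empty context).
-- Adequacy is proved for all instances of a term at once.

consE : ECtx → (ℕ → ECtx) → ℕ → ECtx
consE E π zero    = E
consE E π (suc i) = π i

consT : Tm → (ℕ → Tm) → ℕ → Tm
consT u σ zero    = u
consT u σ (suc i) = σ i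

mutual
  inst : (ℕ → Tm) → (ℕ → ℕ) → (ℕ → ECtx) → Tm → Tm
  inst σ ρ π (var x)        = σ x
  inst σ ρ π (lam A t)      = lam A (inst (exts σ) ρ (λ i → renλE suc (π i)) t)
  inst σ ρ π (app t s)      = app (inst σ ρ π t) (inst σ ρ π s)
  inst σ ρ π (mu A c)       = mu A (instC (λ i → renμ suc (σ i)) (lift ρ) (consE hole (λ i → renμE suc (π i))) c)
  inst σ ρ π zro            = zro
  inst σ ρ π (S t)          = S (inst σ ρ π t)
  inst σ ρ π (nrec A r s t) = nrec A (inst σ ρ π r) (inst σ ρ π s) (inst σ ρ π t)

  instC : (ℕ → Tm) → (ℕ → ℕ) → (ℕ → ECtx) → Cmd → Cmd
  instC σ ρ π (named a t) = named (ρ a) (plug (π a) (inst σ ρ π t))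

mutual
  inst-id : ∀ {σ ρ π} → (∀ x → σ x ≡ var x) → (∀ a → ρ a ≡ a) → (∀ a → π a ≡ hole) → ∀ t → inst σ ρ π t ≡ t
  inst-id hσ hρ hπ (var x)   = hσ x
  inst-id {σ} hσ hρ hπ (lam A t) = cong (lam A) (inst-id hσ' hρ (λ a → cong (renλE suc) (hπ a)) t)
    where hσ' : ∀ x → exts σ x ≡ var x
          hσ' zero    = refl
          hσ' (suc x) = cong (renλ suc) (hσ x)
  inst-id hσ hρ hπ (app t s) = cong₂ app (inst-id hσ hρ hπ t) (inst-id hσ hρ hπ s)
  inst-id {σ} {ρ} {π} hσ hρ hπ (mu A c) =
    cong (mu A) (instC-id (λ x → cong (renμ suc) (hσ x)) (lift-id hρ) hπ' c)
    where hπ' : ∀ a → consE hole (λ i → renμE suc (π i)) a ≡ hole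
          hπ' zero    = refl
          hπ' (suc a) = cong (renμE suc) (hπ a)
  inst-id hσ hρ hπ zro       = refl
  inst-id hσ hρ hπ (S t)     = cong S (inst-id hσ hρ hπ t)
  inst-id hσ hρ hπ (nrec A r s t) = cong₃ (nrec A) (inst-id hσ hρ hπ r) (inst-id hσ hρ hπ s) (inst-id hσ hρ hπ t)

  instC-id : ∀ {σ ρ π} → (∀ x → σ x ≡ var x) → (∀ a → ρ a ≡ a) → (∀ a → π a ≡ hole) → ∀ c → instC σ ρ π c ≡ c
  instC-id {σ} {ρ} {π} hσ hρ hπ (named a t) =
    cong₂ named (hρ a) (trans (cong (λ z → plug z (inst σ ρ π t)) (hπ a)) (inst-id hσ hρ hπ t))

mutual
  renμ-inst : ∀ {σ ρ π σ' ρ' ρ'' π'} → (∀ x → σ' x ≡ renμ ρ' (σ x)) → (∀ a → ρ'' a ≡ ρ' (ρ a)) →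
              (∀ a → π' a ≡ renμE ρ' (π a)) → ∀ t → renμ ρ' (inst σ ρ π t) ≡ inst σ' ρ'' π' t
  renμ-inst hσ hρ hπ (var x)   = sym (hσ x)
  renμ-inst {σ} {ρ} {π} {σ'} {ρ'} {ρ''} {π'} hσ hρ hπ (lam A t) = cong (lam A) (renμ-inst hσ' hρ hπ' t)
    where hσ' : ∀ x → exts σ' x ≡ renμ ρ' (exts σ x)
          hσ' zero    = refl
          hσ' (suc x) = trans (cong (renλ suc) (hσ x)) (sym (renμ-renλ ρ' suc (σ x)))
          hπ' : ∀ a → renλE suc (π' a) ≡ renμE ρ' (renλE suc (π a))
          hπ' a = trans (cong (renλE suc) (hπ a)) (sym (renμE-renλE ρ' suc (π a)))
  renμ-inst hσ hρ hπ (app t s) = cong₂ app (renμ-inst hσ hρ hπ t) (renμ-inst hσ hρ hπ s)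
  renμ-inst {σ} {ρ} {π} {σ'} {ρ'} {ρ''} {π'} hσ hρ hπ (mu A c) = cong (mu A) (renμC-instC hσ' hρ' hπ' c)
    where hσ' : ∀ x → renμ suc (σ' x) ≡ renμ (lift ρ') (renμ suc (σ x))
          hσ' x = trans (cong (renμ suc) (hσ x)) (renμ-weaken ρ' (σ x))
          hρ' : ∀ a → lift ρ'' a ≡ lift ρ' (lift ρ a)
          hρ' zero    = refl
          hρ' (suc a) = cong suc (hρ a)
          hπ' : ∀ a → consE hole (λ i → renμE suc (π' i)) a ≡ renμE (lift ρ') (consE hole (λ i → renμE suc (π i)) a)
          hπ' zero    = refl
          hπ' (suc a) = trans (cong (renμE suc) (hπ a)) (renμE-weaken ρ' (π a))
  renμ-inst hσ hρ hπ zro       = refl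
  renμ-inst hσ hρ hπ (S t)     = cong S (renμ-inst hσ hρ hπ t)
  renμ-inst hσ hρ hπ (nrec A r s t) = cong₃ (nrec A) (renμ-inst hσ hρ hπ r) (renμ-inst hσ hρ hπ s) (renμ-inst hσ hρ hπ t)

  renμC-instC : ∀ {σ ρ π σ' ρ' ρ'' π'} → (∀ x → σ' x ≡ renμ ρ' (σ x)) → (∀ a → ρ'' a ≡ ρ' (ρ a)) →
                (∀ a → π' a ≡ renμE ρ' (π a)) → ∀ c → renμC ρ' (instC σ ρ π c) ≡ instC σ' ρ'' π' c
  renμC-instC {σ} {ρ} {π} {σ'} {ρ'} hσ hρ hπ (named a t) =
    cong₂ named (sym (hρ a)) (trans (plug-renμ ρ' (π a) _) (cong₂ plug (sym (hπ a)) (renμ-inst hσ hρ hπ t)))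

mutual
  sub-inst : ∀ {σ ρ π σ' τ π'} → (∀ x → σ' x ≡ sub τ (σ x)) →
             (∀ a → π' a ≡ subE τ (π a)) → ∀ t → sub τ (inst σ ρ π t) ≡ inst σ' ρ π' t
  sub-inst hσ hπ (var x)   = sym (hσ x)
  sub-inst {σ} {ρ} {π} {σ'} {τ} {π'} hσ hπ (lam A t) = cong (lam A) (sub-inst hσ' hπ' t)
    where hσ' : ∀ x → exts σ' x ≡ sub (exts τ) (exts σ x)
          hσ' zero    = refl
          hσ' (suc x) = trans (cong (renλ suc) (hσ x))
                              (trans (renλ-sub (λ _ → refl) (σ x)) (sym (sub-renλ (λ _ → refl) (σ x))))
          hπ' : ∀ a → renλE suc (π' a) ≡ subE (exts τ) (renλE suc (π a))
          hπ' a = trans (cong (renλE suc) (hπ a))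
                        (trans (renλE-subE (λ _ → refl) (π a)) (sym (subE-renλE (λ _ → refl) (π a))))
  sub-inst hσ hπ (app t s) = cong₂ app (sub-inst hσ hπ t) (sub-inst hσ hπ s)
  sub-inst {σ} {ρ} {π} {σ'} {τ} {π'} hσ hπ (mu A c) = cong (mu A) (subC-instC hσ' hπ' c)
    where hσ' : ∀ x → renμ suc (σ' x) ≡ sub (λ i → renμ suc (τ i)) (renμ suc (σ x))
          hσ' x = trans (cong (renμ suc) (hσ x)) (renμ-sub (λ _ → refl) (σ x))
          hπ' : ∀ a → consE hole (λ i → renμE suc (π' i)) a ≡ subE (λ i → renμ suc (τ i)) (consE hole (λ i → renμE suc (π i)) a)
          hπ' zero    = refl
          hπ' (suc a) = trans (cong (renμE suc) (hπ a)) (renμE-subE (λ _ → refl) (π a))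
  sub-inst hσ hπ zro       = refl
  sub-inst hσ hπ (S t)     = cong S (sub-inst hσ hπ t)
  sub-inst hσ hπ (nrec A r s t) = cong₃ (nrec A) (sub-inst hσ hπ r) (sub-inst hσ hπ s) (sub-inst hσ hπ t)

  subC-instC : ∀ {σ ρ π σ' τ π'} → (∀ x → σ' x ≡ sub τ (σ x)) →
               (∀ a → π' a ≡ subE τ (π a)) → ∀ c → subC τ (instC σ ρ π c) ≡ instC σ' ρ π' c
  subC-instC {σ} {ρ} {π} {σ'} {τ} hσ hπ (named a t) =
    cong (named (ρ a)) (trans (plug-sub τ (π a) _) (cong₂ plug (sym (hπ a)) (sub-inst hσ hπ t)))

-- The context that a name b carrying context H ends up with after a
-- structural substitution of G at k: G is prepended exactly when b = k.
ssubNamed : ℕ → ECtx → ℕ → ECtx → ECtx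
ssubNamed k G b H with b ≟ k
... | yes _ = G ∘E ssubE k G H
... | no _  = ssubE k G H

ssubNamed-hit : ∀ {k G b H} → b ≡ k → ssubNamed k G b H ≡ G ∘E ssubE k G H
ssubNamed-hit {k} {G} {b} {H} e with b ≟ k
... | yes _  = refl
... | no b≢k = ⊥-elim (b≢k e)

ssubNamed-miss : ∀ {k G b H} → ¬ b ≡ k → ssubNamed k G b H ≡ ssubE k G H
ssubNamed-miss {k} {G} {b} {H} b≢k with b ≟ k
... | yes e = ⊥-elim (b≢k e)
... | no _  = refl

renλE-ssubNamed : ∀ ρ k G b H → renλE ρ (ssubNamed k G b H) ≡ ssubNamed k (renλE ρ G) b (renλE ρ H)
renλE-ssubNamed ρ k G b H with b ≟ k
... | yes _ = trans (∘E-renλ ρ G _) (cong (renλE ρ G ∘E_) (renλE-ssubE ρ k G H))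
... | no _  = renλE-ssubE ρ k G H

renμE-ssubNamed : ∀ k G b H → renμE suc (ssubNamed k G b H) ≡ ssubNamed (suc k) (renμE suc G) (suc b) (renμE suc H)
renμE-ssubNamed k G b H with b ≟ k
... | yes e  = trans (∘E-renμ suc G _) (trans (cong (renμE suc G ∘E_) (renμE-ssubE (suc-injectiveAt k) G H))
                 (sym (ssubNamed-hit (cong suc e))))
... | no b≢k = trans (renμE-ssubE (suc-injectiveAt k) G H) (sym (ssubNamed-miss (λ e → b≢k (suc-injective e))))

mutual
  ssub-inst : ∀ {k G σ ρ π σ' π'} → (∀ x → σ' x ≡ ssub k G (σ x)) →
              (∀ a → π' a ≡ ssubNamed k G (ρ a) (π a)) → ∀ t → ssub k G (inst σ ρ π t) ≡ inst σ' ρ π' t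
  ssub-inst hσ hπ (var x)   = sym (hσ x)
  ssub-inst {k} {G} {σ} {ρ} {π} {σ'} {π'} hσ hπ (lam A t) = cong (lam A) (ssub-inst hσ' hπ' t)
    where hσ' : ∀ x → exts σ' x ≡ ssub k (renλE suc G) (exts σ x)
          hσ' zero    = refl
          hσ' (suc x) = trans (cong (renλ suc) (hσ x)) (renλ-ssub suc k G (σ x))
          hπ' : ∀ a → renλE suc (π' a) ≡ ssubNamed k (renλE suc G) (ρ a) (renλE suc (π a))
          hπ' a = trans (cong (renλE suc) (hπ a)) (renλE-ssubNamed suc k G (ρ a) (π a))
  ssub-inst hσ hπ (app t s) = cong₂ app (ssub-inst hσ hπ t) (ssub-inst hσ hπ s)
  ssub-inst {k} {G} {σ} {ρ} {π} {σ'} {π'} hσ hπ (mu A c) = cong (mu A) (ssubC-instC hσ' hπ' c)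
    where hσ' : ∀ x → renμ suc (σ' x) ≡ ssub (suc k) (renμE suc G) (renμ suc (σ x))
          hσ' x = trans (cong (renμ suc) (hσ x)) (renμ-ssub (suc-injectiveAt k) G (σ x))
          hπ' : ∀ a → consE hole (λ i → renμE suc (π' i)) a ≡
                      ssubNamed (suc k) (renμE suc G) (lift ρ a) (consE hole (λ i → renμE suc (π i)) a)
          hπ' zero    = sym (ssubNamed-miss {suc k} {renμE suc G} {zero} {hole} (λ ()))
          hπ' (suc a) = trans (cong (renμE suc) (hπ a)) (renμE-ssubNamed k G (ρ a) (π a))
  ssub-inst hσ hπ zro       = refl
  ssub-inst hσ hπ (S t)     = cong S (ssub-inst hσ hπ t)
  ssub-inst hσ hπ (nrec A r s t) = cong₃ (nrec A) (ssub-inst hσ hπ r) (ssub-inst hσ hπ s) (ssub-inst hσ hπ t)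

  ssubC-instC : ∀ {k G σ ρ π σ' π'} → (∀ x → σ' x ≡ ssub k G (σ x)) →
                (∀ a → π' a ≡ ssubNamed k G (ρ a) (π a)) → ∀ c → ssubC k G (instC σ ρ π c) ≡ instC σ' ρ π' c
  ssubC-instC {k} {G} {σ} {ρ} {π} {σ'} {π'} hσ hπ (named a t) with ρ a ≟ k
  ... | yes e = cong (named (ρ a)) (begin
        plug G (ssub k G (plug (π a) (inst σ ρ π t)))        ≡⟨ cong (plug G) (plug-ssub k G (π a) _) ⟩
        plug G (plug (ssubE k G (π a)) (ssub k G (inst σ ρ π t))) ≡⟨ sym (plug-∘E G _ _) ⟩
        plug (G ∘E ssubE k G (π a)) (ssub k G (inst σ ρ π t)) ≡⟨ cong₂ plug (sym (trans (hπ a) (ssubNamed-hit e)))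
                                                                            (ssub-inst hσ hπ t) ⟩
        plug (π' a) (inst σ' ρ π' t)                          ∎)
    where open ≡-Reasoning
  ... | no ρa≢k = cong (named (ρ a))
        (trans (plug-ssub k G (π a) _) (cong₂ plug (sym (trans (hπ a) (ssubNamed-miss ρa≢k))) (ssub-inst hσ hπ t)))

inst-β : ∀ (σ : ℕ → Tm) (ρ : ℕ → ℕ) (π : ℕ → ECtx) (ρ' : ℕ → ℕ) u t →
         renμ ρ' (inst (exts σ) ρ (λ i → renλE suc (π i)) t) [0:= u ] ≡
         inst (consT u (λ i → renμ ρ' (σ i))) (λ i → ρ' (ρ i)) (λ a → renμE ρ' (π a)) t
inst-β σ ρ π ρ' u t =
  trans (cong (_[0:= u ]) (renμ-inst {σ' = λ x → renμ ρ' (exts σ x)} {ρ'' = λ i → ρ' (ρ i)}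
                             {π' = λ a → renμE ρ' (renλE suc (π a))} (λ _ → refl) (λ _ → refl) (λ _ → refl) t))
        (sub-inst hσ hπ t)
  where hσ : ∀ x → consT u (λ i → renμ ρ' (σ i)) x ≡ renμ ρ' (exts σ x) [0:= u ]
        hσ zero    = refl
        hσ (suc i) = trans (sym (single-weaken u (renμ ρ' (σ i)))) (cong (_[0:= u ]) (sym (renμ-renλ ρ' suc (σ i))))
        hπ : ∀ a → renμE ρ' (π a) ≡ subE (single u) (renμE ρ' (renλE suc (π a)))
        hπ a = trans (sym (single-weakenE u (renμE ρ' (π a)))) (cong (subE (single u)) (sym (renμE-renλE ρ' suc (π a))))

inst-μ : ∀ (σ : ℕ → Tm) (ρ : ℕ → ℕ) (π : ℕ → ECtx) (ρ' : ℕ → ℕ) E c →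
         ssubC 0 (renμE suc E) (renμC (lift ρ') (instC (λ i → renμ suc (σ i)) (lift ρ) (consE hole (λ i → renμE suc (π i))) c)) ≡
         instC (λ x → renμ (λ i → suc (ρ' i)) (σ x)) (λ a → lift ρ' (lift ρ a))
               (consE (renμE suc E) (λ i → renμE (λ j → suc (ρ' j)) (π i))) c
inst-μ σ ρ π ρ' E c =
  trans (cong (ssubC 0 G) (renμC-instC (λ _ → refl) (λ _ → refl) (λ _ → refl) c)) (ssubC-instC hσ hπ c)
  where G = renμE suc E
        hσ : ∀ x → renμ (λ i → suc (ρ' i)) (σ x) ≡ ssub 0 G (renμ (lift ρ') (renμ suc (σ x)))
        hσ x = sym (trans (cong (ssub 0 G) (renμ-fuse (λ _ → refl) (σ x))) (ssub-fresh (λ i ()) G (σ x)))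
        hπ : ∀ a → consE G (λ i → renμE (λ j → suc (ρ' j)) (π i)) a ≡
                   ssubNamed 0 G (lift ρ' (lift ρ a)) (renμE (lift ρ') (consE hole (λ i → renμE suc (π i)) a))
        hπ zero    = sym (trans (ssubNamed-hit {0} {G} {0} {hole} refl) (∘E-hole G))
        hπ (suc i) = sym (trans (ssubNamed-miss {b = suc (ρ' (ρ i))} (λ ()))
                       (trans (cong (ssubE 0 G) (renμE-fuse {ρ₃ = λ j → suc (ρ' j)} (λ _ → refl) (π i)))
                              (ssubE-fresh {ρ = λ j → suc (ρ' j)} (λ j ()) G (π i))))

infix 4 _⟶E_

data _⟶E_ : ECtx → ECtx → Set where
  appE₁  : ∀ {E E' t} → E ⟶E E' → appE E t ⟶E appE E' t
  appE₂  : ∀ {E t t'} → t ⟶ t' → appE E t ⟶E appE E t'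
  SE₁    : ∀ {E E'} → E ⟶E E' → SE E ⟶E SE E'
  nrecE₁ : ∀ {A r r' s E} → r ⟶ r' → nrecE A r s E ⟶E nrecE A r' s E
  nrecE₂ : ∀ {A r s s' E} → s ⟶ s' → nrecE A r s E ⟶E nrecE A r s' E
  nrecE₃ : ∀ {A r s E E'} → E ⟶E E' → nrecE A r s E ⟶E nrecE A r s E'

_⟶*_ : Tm → Tm → Set
_⟶*_ = Star _⟶_

_⟶C*_ : Cmd → Cmd → Set
_⟶C*_ = Star _⟶C_

plug-⟶ : ∀ E {X X'} → X ⟶ X' → plug E X ⟶ plug E X'
plug-⟶ hole            r = r
plug-⟶ (appE E t)      r = ξappl (plug-⟶ E r)
plug-⟶ (SE E)          r = ξS (plug-⟶ E r)
plug-⟶ (nrecE A a b E) r = ξnrec₃ (plug-⟶ E r)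

plug-⟶E : ∀ {E E'} X → E ⟶E E' → plug E X ⟶ plug E' X
plug-⟶E X (appE₁ e)  = ξappl (plug-⟶E X e)
plug-⟶E X (appE₂ r)  = ξappr r
plug-⟶E X (SE₁ e)    = ξS (plug-⟶E X e)
plug-⟶E X (nrecE₁ r) = ξnrec₁ r
plug-⟶E X (nrecE₂ r) = ξnrec₂ r
plug-⟶E X (nrecE₃ e) = ξnrec₃ (plug-⟶E X e)

∘E-⟶E : ∀ {E E'} F → E ⟶E E' → E ∘E F ⟶E E' ∘E F
∘E-⟶E F (appE₁ e)  = appE₁ (∘E-⟶E F e)
∘E-⟶E F (appE₂ r)  = appE₂ r
∘E-⟶E F (SE₁ e)    = SE₁ (∘E-⟶E F e)
∘E-⟶E F (nrecE₁ r) = nrecE₁ r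
∘E-⟶E F (nrecE₂ r) = nrecE₂ r
∘E-⟶E F (nrecE₃ e) = nrecE₃ (∘E-⟶E F e)

depth-⟶E : ∀ {E E'} → E ⟶E E' → depth E' ≡ depth E
depth-⟶E (appE₁ e)  = cong suc (depth-⟶E e)
depth-⟶E (appE₂ r)  = refl
depth-⟶E (SE₁ e)    = cong suc (depth-⟶E e)
depth-⟶E (nrecE₁ r) = refl
depth-⟶E (nrecE₂ r) = refl
depth-⟶E (nrecE₃ e) = cong suc (depth-⟶E e)

-- Stability of reduction under the syntactic operations.  Each base rule
-- is mapped to the same rule, up to an equation of the algebra above.

retarget : ∀ {a b b'} → b ≡ b' → a ⟶ b → a ⟶ b'
retarget refl r = r

-- The nrecS rule for a term that is a numeral only up to an equation.
nrecS-num : ∀ {A r s m} n → m ≡ num n → nrec A r s (S m) ⟶ app (app s m) (nrec A r s m)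
nrecS-num n refl = nrecS

mutual
  sub-⟶ : ∀ σ {t t'} → t ⟶ t' → sub σ t ⟶ sub σ t'
  sub-⟶ σ (β {A} {t} {r}) = retarget (sym (sub-β σ t r)) β
  sub-⟶ σ (μS {A} {c}) = retarget (cong (mu A) (ssubC-subC fresh refl c)) μS
    where fresh = λ x → sym (ssub-fresh suc-avoids-0 _ (σ x))
  sub-⟶ σ (μapp {A} {c} {s}) =
    retarget (cong (mu A) (ssubC-subC fresh (cong (appE hole) (sym (renμ-sub (λ _ → refl) s))) c)) μapp
    where fresh = λ x → sym (ssub-fresh suc-avoids-0 _ (σ x))
  sub-⟶ σ nrec0 = nrec0
  sub-⟶ σ (nrecS {n = n}) = nrecS-num n (num-sub σ n)
  sub-⟶ σ (nrecμ {A} {B} {r} {s} {c}) =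
    retarget (cong (mu B) (ssubC-subC fresh (cong₂ (λ a b → nrecE A a b hole)
               (sym (renμ-sub (λ _ → refl) r)) (sym (renμ-sub (λ _ → refl) s))) c)) nrecμ
    where fresh = λ x → sym (ssub-fresh suc-avoids-0 _ (σ x))
  sub-⟶ σ (ξlam r)   = ξlam (sub-⟶ (exts σ) r)
  sub-⟶ σ (ξappl r)  = ξappl (sub-⟶ σ r)
  sub-⟶ σ (ξappr r)  = ξappr (sub-⟶ σ r)
  sub-⟶ σ (ξmu r)    = ξmu (subC-⟶C (λ i → renμ suc (σ i)) r)
  sub-⟶ σ (ξS r)     = ξS (sub-⟶ σ r)
  sub-⟶ σ (ξnrec₁ r) = ξnrec₁ (sub-⟶ σ r)
  sub-⟶ σ (ξnrec₂ r) = ξnrec₂ (sub-⟶ σ r)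
  sub-⟶ σ (ξnrec₃ r) = ξnrec₃ (sub-⟶ σ r)

  subC-⟶C : ∀ σ {c c'} → c ⟶C c' → subC σ c ⟶C subC σ c'
  subC-⟶C σ (ξnamed r) = ξnamed (sub-⟶ σ r)

injectiveAt-lift-0 : ∀ ρ → InjectiveAt (lift ρ) zero
injectiveAt-lift-0 ρ zero    e = refl
injectiveAt-lift-0 ρ (suc a) ()

mutual
  renμ-⟶ : ∀ ρ {t t'} → t ⟶ t' → renμ ρ t ⟶ renμ ρ t'
  renμ-⟶ ρ (β {A} {t} {r}) = retarget (sym (renμ-β ρ t r)) β
  renμ-⟶ ρ (μS {A} {c}) = retarget (cong (mu A) (sym (renμC-ssubC (injectiveAt-lift-0 ρ) _ c))) μS
  renμ-⟶ ρ (μapp {A} {c} {s}) = retarget (cong (mu A) (trans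
    (cong (λ z → ssubC 0 (appE hole z) (renμC (lift ρ) c)) (renμ-weaken ρ s))
    (sym (renμC-ssubC (injectiveAt-lift-0 ρ) _ c)))) μapp
  renμ-⟶ ρ nrec0 = nrec0
  renμ-⟶ ρ (nrecS {n = n}) = nrecS-num n (num-renμ ρ n)
  renμ-⟶ ρ (nrecμ {A} {B} {r} {s} {c}) = retarget (cong (mu B) (trans
    (cong₂ (λ a b → ssubC 0 (nrecE A a b hole) (renμC (lift ρ) c)) (renμ-weaken ρ r) (renμ-weaken ρ s))
    (sym (renμC-ssubC (injectiveAt-lift-0 ρ) _ c)))) nrecμ
  renμ-⟶ ρ (ξlam r)   = ξlam (renμ-⟶ ρ r)
  renμ-⟶ ρ (ξappl r)  = ξappl (renμ-⟶ ρ r)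
  renμ-⟶ ρ (ξappr r)  = ξappr (renμ-⟶ ρ r)
  renμ-⟶ ρ (ξmu r)    = ξmu (renμC-⟶C (lift ρ) r)
  renμ-⟶ ρ (ξS r)     = ξS (renμ-⟶ ρ r)
  renμ-⟶ ρ (ξnrec₁ r) = ξnrec₁ (renμ-⟶ ρ r)
  renμ-⟶ ρ (ξnrec₂ r) = ξnrec₂ (renμ-⟶ ρ r)
  renμ-⟶ ρ (ξnrec₃ r) = ξnrec₃ (renμ-⟶ ρ r)

  renμC-⟶C : ∀ ρ {c c'} → c ⟶C c' → renμC ρ c ⟶C renμC ρ c'
  renμC-⟶C ρ (ξnamed r) = ξnamed (renμ-⟶ ρ r)

mutual
  renλ-⟶ : ∀ ρ {t t'} → t ⟶ t' → renλ ρ t ⟶ renλ ρ t'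
  renλ-⟶ ρ (β {A} {t} {r}) = retarget (sym (renλ-β ρ t r)) β
  renλ-⟶ ρ (μS {A} {c}) = retarget (cong (mu A) (sym (renλC-ssubC ρ 0 _ c))) μS
  renλ-⟶ ρ (μapp {A} {c} {s}) = retarget (cong (mu A) (trans
    (cong (λ z → ssubC 0 (appE hole z) (renλC ρ c)) (renμ-renλ suc ρ s))
    (sym (renλC-ssubC ρ 0 _ c)))) μapp
  renλ-⟶ ρ nrec0 = nrec0
  renλ-⟶ ρ (nrecS {n = n}) = nrecS-num n (num-renλ ρ n)
  renλ-⟶ ρ (nrecμ {A} {B} {r} {s} {c}) = retarget (cong (mu B) (trans
    (cong₂ (λ a b → ssubC 0 (nrecE A a b hole) (renλC ρ c)) (renμ-renλ suc ρ r) (renμ-renλ suc ρ s))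
    (sym (renλC-ssubC ρ 0 _ c)))) nrecμ
  renλ-⟶ ρ (ξlam r)   = ξlam (renλ-⟶ (lift ρ) r)
  renλ-⟶ ρ (ξappl r)  = ξappl (renλ-⟶ ρ r)
  renλ-⟶ ρ (ξappr r)  = ξappr (renλ-⟶ ρ r)
  renλ-⟶ ρ (ξmu r)    = ξmu (renλC-⟶C ρ r)
  renλ-⟶ ρ (ξS r)     = ξS (renλ-⟶ ρ r)
  renλ-⟶ ρ (ξnrec₁ r) = ξnrec₁ (renλ-⟶ ρ r)
  renλ-⟶ ρ (ξnrec₂ r) = ξnrec₂ (renλ-⟶ ρ r)
  renλ-⟶ ρ (ξnrec₃ r) = ξnrec₃ (renλ-⟶ ρ r)

  renλC-⟶C : ∀ ρ {c c'} → c ⟶C c' → renλC ρ c ⟶C renλC ρ c'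
  renλC-⟶C ρ (ξnamed r) = ξnamed (renλ-⟶ ρ r)

-- For structural substitution, a μ-step of the term at a fresh name 0 commutes
-- with the substitution at suc k by ssub-ssub-distinct.
mutual
  ssub-⟶ : ∀ k G {t t'} → t ⟶ t' → ssub k G t ⟶ ssub k G t'
  ssub-⟶ k G (β {A} {t} {r}) = retarget (sym (ssub-sub h (single-weakenE _ G) t)) β
    where h : ∀ x → single (ssub k G r) x ≡ ssub k G (single r x)
          h zero    = refl
          h (suc x) = refl
  ssub-⟶ k G (μS {A} {c}) = retarget (cong (mu A)
    (sym (ssubC-ssubC-distinct {zero} {suc k} (λ ()) {ρ = suc} {G₀ = G} suc-avoids-0 refl (SE hole) c))) μS
  ssub-⟶ k G (μapp {A} {c} {s}) = retarget (cong (mu A) (trans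
    (cong (λ z → ssubC 0 (appE hole z) (ssubC (suc k) (renμE suc G) c)) (renμ-ssub (suc-injectiveAt k) G s))
    (sym (ssubC-ssubC-distinct {zero} {suc k} (λ ()) {ρ = suc} {G₀ = G} suc-avoids-0 refl _ c)))) μapp
  ssub-⟶ k G nrec0 = nrec0
  ssub-⟶ k G (nrecS {n = n}) = nrecS-num n (num-ssub k G n)
  ssub-⟶ k G (nrecμ {A} {B} {r} {s} {c}) = retarget (cong (mu B) (trans
    (cong₂ (λ a b → ssubC 0 (nrecE A a b hole) (ssubC (suc k) (renμE suc G) c))
      (renμ-ssub (suc-injectiveAt k) G r) (renμ-ssub (suc-injectiveAt k) G s))
    (sym (ssubC-ssubC-distinct {zero} {suc k} (λ ()) {ρ = suc} {G₀ = G} suc-avoids-0 refl _ c)))) nrecμ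
  ssub-⟶ k G (ξlam r)   = ξlam (ssub-⟶ k (renλE suc G) r)
  ssub-⟶ k G (ξappl r)  = ξappl (ssub-⟶ k G r)
  ssub-⟶ k G (ξappr r)  = ξappr (ssub-⟶ k G r)
  ssub-⟶ k G (ξmu r)    = ξmu (ssubC-⟶C (suc k) (renμE suc G) r)
  ssub-⟶ k G (ξS r)     = ξS (ssub-⟶ k G r)
  ssub-⟶ k G (ξnrec₁ r) = ξnrec₁ (ssub-⟶ k G r)
  ssub-⟶ k G (ξnrec₂ r) = ξnrec₂ (ssub-⟶ k G r)
  ssub-⟶ k G (ξnrec₃ r) = ξnrec₃ (ssub-⟶ k G r)

  ssubC-⟶C : ∀ k G {c c'} → c ⟶C c' → ssubC k G c ⟶C ssubC k G c'
  ssubC-⟶C k G (ξnamed {b} r) with b ≟ k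
  ... | yes _ = ξnamed (plug-⟶ G (ssub-⟶ k G r))
  ... | no _  = ξnamed (ssub-⟶ k G r)

renλE-⟶E : ∀ ρ {E E'} → E ⟶E E' → renλE ρ E ⟶E renλE ρ E'
renλE-⟶E ρ (appE₁ e)  = appE₁ (renλE-⟶E ρ e)
renλE-⟶E ρ (appE₂ r)  = appE₂ (renλ-⟶ ρ r)
renλE-⟶E ρ (SE₁ e)    = SE₁ (renλE-⟶E ρ e)
renλE-⟶E ρ (nrecE₁ r) = nrecE₁ (renλ-⟶ ρ r)
renλE-⟶E ρ (nrecE₂ r) = nrecE₂ (renλ-⟶ ρ r)
renλE-⟶E ρ (nrecE₃ e) = nrecE₃ (renλE-⟶E ρ e)

renμE-⟶E : ∀ ρ {E E'} → E ⟶E E' → renμE ρ E ⟶E renμE ρ E'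
renμE-⟶E ρ (appE₁ e)  = appE₁ (renμE-⟶E ρ e)
renμE-⟶E ρ (appE₂ r)  = appE₂ (renμ-⟶ ρ r)
renμE-⟶E ρ (SE₁ e)    = SE₁ (renμE-⟶E ρ e)
renμE-⟶E ρ (nrecE₁ r) = nrecE₁ (renμ-⟶ ρ r)
renμE-⟶E ρ (nrecE₂ r) = nrecE₂ (renμ-⟶ ρ r)
renμE-⟶E ρ (nrecE₃ e) = nrecE₃ (renμE-⟶E ρ e)

-- A step of the substituted context G yields finitely many steps of the
-- result (one per occurrence of the name).
mutual
  ssub-⟶E : ∀ k {G G'} → G ⟶E G' → ∀ t → ssub k G t ⟶* ssub k G' t
  ssub-⟶E k e (var x)   = ε
  ssub-⟶E k e (lam A t) = gmap (lam A) ξlam (ssub-⟶E k (renλE-⟶E suc e) t)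
  ssub-⟶E k {G} {G'} e (app t s) =
    gmap (λ z → app z (ssub k G s)) ξappl (ssub-⟶E k e t) ◅◅ gmap (app (ssub k G' t)) ξappr (ssub-⟶E k e s)
  ssub-⟶E k e (mu A c)  = gmap (mu A) ξmu (ssubC-⟶E (suc k) (renμE-⟶E suc e) c)
  ssub-⟶E k e zro       = ε
  ssub-⟶E k e (S t)     = gmap S ξS (ssub-⟶E k e t)
  ssub-⟶E k {G} {G'} e (nrec A a b t) =
    gmap (λ z → nrec A z (ssub k G b) (ssub k G t)) ξnrec₁ (ssub-⟶E k e a) ◅◅
    gmap (λ z → nrec A (ssub k G' a) z (ssub k G t)) ξnrec₂ (ssub-⟶E k e b) ◅◅
    gmap (nrec A (ssub k G' a) (ssub k G' b)) ξnrec₃ (ssub-⟶E k e t)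

  ssubC-⟶E : ∀ k {G G'} → G ⟶E G' → ∀ c → ssubC k G c ⟶C* ssubC k G' c
  ssubC-⟶E k {G} {G'} e (named b q) with b ≟ k
  ... | yes _ = ξnamed (plug-⟶E _ e) ◅ gmap (λ z → named b (plug G' z)) (λ r → ξnamed (plug-⟶ G' r)) (ssub-⟶E k e q)
  ... | no _  = gmap (named b) ξnamed (ssub-⟶E k e q)

data SNC (c : Cmd) : Set where
  snc : (∀ {c'} → c ⟶C c' → SNC c') → SNC c

data SNE (E : ECtx) : Set where
  sne : (∀ {E'} → E ⟶E E' → SNE E') → SNE E

SN-⟶ : ∀ {t t'} → SN t → t ⟶ t' → SN t'
SN-⟶ (sn h) r = h r

SNC-⟶C* : ∀ {c c'} → SNC c → c ⟶C* c' → SNC c'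
SNC-⟶C* s           ε       = s
SNC-⟶C* (snc h) (r ◅ rs) = SNC-⟶C* (h r) rs

SN-named : ∀ {a t} → SN t → SNC (named a t)
SN-named (sn h) = snc λ { (ξnamed r) → SN-named (h r) }

SN-plug-inv : ∀ E {X s} → SN s → s ≡ plug E X → SN X
SN-plug-inv E (sn h) refl = sn λ r → SN-plug-inv E (h (plug-⟶ E r)) refl

SNE-plug-inv : ∀ {E X s} → SN s → s ≡ plug E X → SNE E
SNE-plug-inv {E} {X} (sn h) refl = sne λ e → SNE-plug-inv (h (plug-⟶E X e)) refl

SNE-∘E-inv : ∀ {E F G} → SNE G → G ≡ E ∘E F → SNE E
SNE-∘E-inv {E} {F} (sne h) refl = sne λ e → SNE-∘E-inv (h (∘E-⟶E F e)) refl

sne-hole : SNE hole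
sne-hole = sne λ ()

mutual
  sne-app : ∀ {F u} → SNE F → SN u → SNE (appE F u)
  sne-app sF sU = sne (sne-app-step sF sU)

  sne-app-step : ∀ {F u E'} → SNE F → SN u → appE F u ⟶E E' → SNE E'
  sne-app-step (sne hF) sU       (appE₁ e) = sne-app (hF e) sU
  sne-app-step sF       (sn hU)  (appE₂ r) = sne-app sF (hU r)

sne-S : ∀ {F} → SNE F → SNE (SE F)
sne-S (sne hF) = sne λ { (SE₁ e) → sne-S (hF e) }

mutual
  sne-nrec : ∀ {B r s F} → SN r → SN s → SNE F → SNE (nrecE B r s F)
  sne-nrec sR sS sF = sne (sne-nrec-step sR sS sF)

  sne-nrec-step : ∀ {B r s F E'} → SN r → SN s → SNE F → nrecE B r s F ⟶E E' → SNE E'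
  sne-nrec-step (sn hR) sS      sF       (nrecE₁ r) = sne-nrec (hR r) sS sF
  sne-nrec-step sR      (sn hS) sF       (nrecE₂ r) = sne-nrec sR (hS r) sF
  sne-nrec-step sR      sS      (sne hF) (nrecE₃ e) = sne-nrec sR sS (hF e)

data Num : Tm → Set where
  numZ : Num zro
  numS : ∀ {m} → Num m → Num (S m)

num-Num : ∀ n → Num (num n)
num-Num zero    = numZ
num-Num (suc n) = numS (num-Num n)

Num-normal : ∀ {m m'} → Num m → ¬ m ⟶ m'
Num-normal numZ     ()
Num-normal (numS p) (ξS r) = Num-normal p r

SN-Num : ∀ {m} → Num m → SN m
SN-Num p = sn λ r → ⊥-elim (Num-normal p r)

-- Classification of the reducts of E[X] when X is not an introduction form
-- (λ, 0, S): either E reduces, or X reduces, or X is a μ-abstraction that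
-- absorbs the innermost frame F of E.

data NonCanonical : Tm → Set where
  nc-var  : ∀ {x} → NonCanonical (var x)
  nc-app  : ∀ {t s} → NonCanonical (app t s)
  nc-nrec : ∀ {A r s t} → NonCanonical (nrec A r s t)
  nc-mu   : ∀ {A c} → NonCanonical (mu A c)

-- One-layer contexts: the frames a μ-abstraction can absorb.
data Frame : ECtx → Set where
  fr-app  : ∀ {u} → Frame (appE hole u)
  fr-S    : Frame (SE hole)
  fr-nrec : ∀ {A r s} → Frame (nrecE A r s hole)

depth-∘-frame : ∀ E {F} → Frame F → depth (E ∘E F) ≡ suc (depth E)
depth-∘-frame hole            fr-app  = refl
depth-∘-frame hole            fr-S    = refl
depth-∘-frame hole            fr-nrec = refl
depth-∘-frame (appE E t)      fr      = cong suc (depth-∘-frame E fr)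
depth-∘-frame (SE E)          fr      = cong suc (depth-∘-frame E fr)
depth-∘-frame (nrecE A r s E) fr      = cong suc (depth-∘-frame E fr)

data PlugStep (E : ECtx) (X Y : Tm) : Set where
  ctx-step  : ∀ {E'} → E ⟶E E' → Y ≡ plug E' X → PlugStep E X Y
  hole-step : ∀ {X'} → X ⟶ X' → Y ≡ plug E X' → PlugStep E X Y
  μ-step    : ∀ E₂ F A c → Frame F → X ≡ mu A c → E ≡ E₂ ∘E F →
              Y ≡ plug E₂ (mu A (ssubC 0 (renμE suc F) c)) → PlugStep E X Y

plug-not-lam : ∀ {X A t} → NonCanonical X → ∀ E → ¬ plug E X ≡ lam A t
plug-not-lam nc-var  hole ()
plug-not-lam nc-app  hole ()
plug-not-lam nc-nrec hole ()
plug-not-lam nc-mu   hole ()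
plug-not-lam nc (appE E x)      ()
plug-not-lam nc (SE E)          ()
plug-not-lam nc (nrecE A r s E) ()

plug-not-Num : ∀ {X} → NonCanonical X → ∀ E → ¬ Num (plug E X)
plug-not-Num nc-var  hole ()
plug-not-Num nc-app  hole ()
plug-not-Num nc-nrec hole ()
plug-not-Num nc-mu   hole ()
plug-not-Num nc (appE E x)      ()
plug-not-Num nc (SE E) (numS p) = plug-not-Num nc E p
plug-not-Num nc (nrecE A r s E) ()

plug-mu : ∀ {X A c} E → plug E X ≡ mu A c → E ≡ hole
plug-mu hole            e = refl
plug-mu (appE E x)      ()
plug-mu (SE E)          ()
plug-mu (nrecE A r s E) ()

mutual
  plugStep : ∀ E {X Y} → NonCanonical X → plug E X ⟶ Y → PlugStep E X Y
  plugStep hole            nc r = hole-step r refl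
  plugStep (appE E u)      nc r = plugStep-app E u nc refl r
  plugStep (SE E)          nc r = plugStep-S E nc refl r
  plugStep (nrecE A a b E) nc r = plugStep-nrec E A a b nc refl r

  plugStep-under : ∀ {E X W Y} (f : ECtx → ECtx) (g : Tm → Tm) → (∀ {E₁ E₂} → E₁ ⟶E E₂ → f E₁ ⟶E f E₂) →
                   (∀ E₂ F → f (E₂ ∘E F) ≡ f E₂ ∘E F) → (∀ E' Z → g (plug E' Z) ≡ plug (f E') Z) →
                   Y ≡ g W → PlugStep E X W → PlugStep (f E) X Y
  plugStep-under f g hf h∘ hplug refl (ctx-step e refl)  = ctx-step (hf e) (hplug _ _)
  plugStep-under f g hf h∘ hplug refl (hole-step r refl) = hole-step r (hplug _ _)
  plugStep-under f g hf h∘ hplug refl (μ-step E₂ F A c fr p refl refl) =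
    μ-step (f E₂) F A c fr p (h∘ E₂ F) (hplug E₂ _)

  plugStep-app : ∀ E u {X W Y} → NonCanonical X → plug E X ≡ W → app W u ⟶ Y → PlugStep (appE E u) X Y
  plugStep-app E u nc eq β = ⊥-elim (plug-not-lam nc E eq)
  plugStep-app E u nc eq μapp with plug-mu E eq
  ... | refl = μ-step hole (appE hole u) _ _ fr-app eq refl refl
  plugStep-app E u nc refl (ξappl r) =
    plugStep-under (λ z → appE z u) (λ z → app z u) appE₁ (λ _ _ → refl) (λ _ _ → refl) refl (plugStep E nc r)
  plugStep-app E u nc refl (ξappr r) = ctx-step (appE₂ r) refl

  plugStep-S : ∀ E {X W Y} → NonCanonical X → plug E X ≡ W → S W ⟶ Y → PlugStep (SE E) X Y
  plugStep-S E nc eq μS with plug-mu E eq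
  ... | refl = μ-step hole (SE hole) _ _ fr-S eq refl refl
  plugStep-S E nc refl (ξS r) = plugStep-under SE S SE₁ (λ _ _ → refl) (λ _ _ → refl) refl (plugStep E nc r)

  plugStep-nrec : ∀ E A a b {X W Y} → NonCanonical X → plug E X ≡ W → nrec A a b W ⟶ Y → PlugStep (nrecE A a b E) X Y
  plugStep-nrec E A a b nc eq nrec0 = ⊥-elim (plug-not-Num nc E (subst Num (sym eq) numZ))
  plugStep-nrec E A a b nc eq (nrecS {n = n}) = ⊥-elim (plug-not-Num nc E (subst Num (sym eq) (numS (num-Num n))))
  plugStep-nrec E A a b nc eq nrecμ with plug-mu E eq
  ... | refl = μ-step hole (nrecE A a b hole) _ _ fr-nrec eq refl refl
  plugStep-nrec E A a b nc refl (ξnrec₁ r) = ctx-step (nrecE₁ r) refl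
  plugStep-nrec E A a b nc refl (ξnrec₂ r) = ctx-step (nrecE₂ r) refl
  plugStep-nrec E A a b nc refl (ξnrec₃ r) =
    plugStep-under (nrecE A a b) (nrec A a b) nrecE₃ (λ _ _ → refl) (λ _ _ → refl) refl (plugStep E nc r)

-- Each lemma shows that E[X] is SN from SN of the
-- contractum (and of the parts of X that the contraction may erase), by
-- induction on these SN proofs, using the classification of reducts.

-- Absorbing a frame F into μα.c and then the rest E₂ of the
-- context is the same as absorbing E₂ ∘ F at once, so the measure
-- "depth of E" decreases along μ-steps while the command stays SN.
ssubC-∘-frame : ∀ E₂ F c → ssubC 0 (renμE suc E₂) (ssubC 0 (renμE suc F) c) ≡ ssubC 0 (renμE suc (E₂ ∘E F)) c
ssubC-∘-frame E₂ F c = trans (ssubC-ssubC-same 0 (renμE suc E₂) (renμE suc F) c)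
  (cong (λ z → ssubC 0 z c)
    (trans (cong (renμE suc E₂ ∘E_) (ssubE-fresh suc-avoids-0 (renμE suc E₂) F)) (sym (∘E-renμ suc E₂ F))))

mutual
  SN-μ : ∀ n E → depth E ≡ n → SNE E → ∀ A c → SNC (ssubC 0 (renμE suc E) c) → SN (plug E (mu A c))
  SN-μ n E d sE A c sC = sn λ r → SN-μ-step n E d sE A c sC (plugStep E nc-mu r)

  SN-μ-step : ∀ n E → depth E ≡ n → SNE E → ∀ A c → SNC (ssubC 0 (renμE suc E) c) →
              ∀ {Y} → PlugStep E (mu A c) Y → SN Y
  SN-μ-step n E d (sne hE) A c sC (ctx-step e refl) =
    SN-μ n _ (trans (depth-⟶E e) d) (hE e) A c (SNC-⟶C* sC (ssubC-⟶E 0 (renμE-⟶E suc e) c))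
  SN-μ-step n E d sE A c (snc hC) (hole-step (ξmu r) refl) = SN-μ n E d sE A _ (hC (ssubC-⟶C 0 _ r))
  SN-μ-step zero E d sE A c sC (μ-step E₂ F A c fr refl refl refl) with trans (sym (depth-∘-frame E₂ fr)) d
  ... | ()
  SN-μ-step (suc n) E d sE A c sC (μ-step E₂ F A c fr refl refl refl) =
    SN-μ n E₂ (suc-injective (trans (sym (depth-∘-frame E₂ fr)) d)) (SNE-∘E-inv sE refl) A _
      (subst SNC (sym (ssubC-∘-frame E₂ F c)) sC)

module Expansion-β {P : Tm → Set} (P-⟶ : ∀ {u u'} → P u → u ⟶ u' → P u') where
  mutual
    SN-β : ∀ A u → P u → SN u → ∀ b E → (∀ u' → P u' → SN (plug E (b [0:= u' ]))) →
           SN (plug E (b [0:= u ])) → SN (plug E (app (lam A b) u))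
    SN-β A u pu su b E H sk = sn λ r → SN-β-step A u pu su b E H sk (plugStep E nc-app r)

    SN-β-step : ∀ A u → P u → SN u → ∀ b E → (∀ u' → P u' → SN (plug E (b [0:= u' ]))) →
                SN (plug E (b [0:= u ])) → ∀ {Y} → PlugStep E (app (lam A b) u) Y → SN Y
    SN-β-step A u pu su b E H (sn hk) (ctx-step e refl) =
      SN-β A u pu su b _ (λ u' p → SN-⟶ (H u' p) (plug-⟶E _ e)) (hk (plug-⟶E _ e))
    SN-β-step A u pu su b E H sk (hole-step β refl) = sk
    SN-β-step A u pu su b E H (sn hk) (hole-step (ξappl (ξlam rb)) refl) =
      SN-β A u pu su _ E (λ u' p → SN-⟶ (H u' p) (plug-⟶ E (sub-⟶ _ rb))) (hk (plug-⟶ E (sub-⟶ _ rb)))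
    SN-β-step A u pu (sn hu) b E H sk (hole-step (ξappr ru) refl) =
      SN-β A _ (P-⟶ pu ru) (hu ru) b E H (H _ (P-⟶ pu ru))
    SN-β-step A u pu su b E H sk (μ-step _ _ _ _ _ () _ _)

mutual
  SN-nrec0 : ∀ B r s E → SN s → SN (plug E r) → SN (plug E (nrec B r s zro))
  SN-nrec0 B r s E ss sk = sn λ x → SN-nrec0-step B r s E ss sk (plugStep E nc-nrec x)

  SN-nrec0-step : ∀ B r s E → SN s → SN (plug E r) → ∀ {Y} → PlugStep E (nrec B r s zro) Y → SN Y
  SN-nrec0-step B r s E ss (sn hk) (ctx-step e refl)          = SN-nrec0 B r s _ ss (hk (plug-⟶E _ e))
  SN-nrec0-step B r s E ss sk      (hole-step nrec0 refl)      = sk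
  SN-nrec0-step B r s E ss (sn hk) (hole-step (ξnrec₁ x) refl) = SN-nrec0 B _ s E ss (hk (plug-⟶ E x))
  SN-nrec0-step B r s E (sn hs) sk (hole-step (ξnrec₂ x) refl) = SN-nrec0 B r _ E (hs x) sk
  SN-nrec0-step B r s E ss sk      (hole-step (ξnrec₃ ()) refl)
  SN-nrec0-step B r s E ss sk      (μ-step _ _ _ _ _ () _ _)

mutual
  SN-nrecS : ∀ B r s m → Num m → ∀ E → SN s → SN (plug E (app (app s m) (nrec B r s m))) →
             SN (plug E (nrec B r s (S m)))
  SN-nrecS B r s m pm E ss sk = sn λ x → SN-nrecS-step B r s m pm E ss sk (plugStep E nc-nrec x)

  SN-nrecS-step : ∀ B r s m → Num m → ∀ E → SN s → SN (plug E (app (app s m) (nrec B r s m))) →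
                  ∀ {Y} → PlugStep E (nrec B r s (S m)) Y → SN Y
  SN-nrecS-step B r s m pm E ss (sn hk) (ctx-step e refl) = SN-nrecS B r s m pm _ ss (hk (plug-⟶E _ e))
  SN-nrecS-step B r s m pm E ss sk (hole-step nrecS refl) = sk
  SN-nrecS-step B r s m pm E ss (sn hk) (hole-step (ξnrec₁ x) refl) =
    SN-nrecS B _ s m pm E ss (hk (plug-⟶ E (ξappr (ξnrec₁ x))))
  SN-nrecS-step B r s m pm E (sn hs) sk (hole-step (ξnrec₂ x) refl) =
    SN-nrecS B r _ m pm E (hs x) (SN-⟶ (SN-⟶ sk (plug-⟶ E (ξappl (ξappl x)))) (plug-⟶ E (ξappr (ξnrec₂ x))))
  SN-nrecS-step B r s m pm E ss sk (hole-step (ξnrec₃ (ξS x)) refl) = ⊥-elim (Num-normal pm x)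
  SN-nrecS-step B r s m () E ss sk (hole-step (ξnrec₃ μS) refl)
  SN-nrecS-step B r s m pm E ss sk (μ-step _ _ _ _ _ () _ _)

mutual
  SN-var : ∀ {F x} → SNE F → SN (plug F (var x))
  SN-var {F} sF = sn λ r → SN-var-step sF (plugStep F nc-var r)

  SN-var-step : ∀ {F x} → SNE F → ∀ {Y} → PlugStep F (var x) Y → SN Y
  SN-var-step (sne hF) (ctx-step e refl)     = SN-var (hF e)
  SN-var-step sF       (hole-step () _)
  SN-var-step sF       (μ-step _ _ _ _ _ () _ _)

-- Orth E says that E turns numerals and SN neutral terms
-- into SN terms.  ⟦ A ⟧ is the set of terms t such that E[t'] is SN for
-- every μ-renaming t' of t and every E ∈ 𝒦 A; the quantification over
-- renamings makes ⟦ A ⟧ stable under renaming of μ-names.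

Orth : ECtx → Set
Orth E = (∀ n → SN (plug E (num n))) × (∀ F x → SNE F → SN (plug E (plug F (var x))))

mutual
  ⟦_⟧ : Ty → Tm → Set
  ⟦ A ⟧ t = ∀ ρ E → 𝒦 A E → SN (plug E (renμ ρ t))

  𝒦 : Ty → ECtx → Set
  𝒦 Nat     E = ∀ ρ → Orth (renμE ρ E)
  𝒦 (A ⇒ B) E = Σ ECtx λ E₁ → Σ Tm λ u → (E ≡ E₁ ∘E appE hole u) × ⟦ A ⟧ u × 𝒦 B E₁

⟦⟧-ren : ∀ {A t} ρ → ⟦ A ⟧ t → ⟦ A ⟧ (renμ ρ t)
⟦⟧-ren {A} {t} ρ h ρ' E k = subst (λ z → SN (plug E z)) (sym (renμ-fuse (λ _ → refl) t)) (h (λ i → ρ' (ρ i)) E k)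

𝒦-ren : ∀ A {E} ρ → 𝒦 A E → 𝒦 A (renμE ρ E)
𝒦-ren Nat {E} ρ k ρ' = subst Orth (sym (renμE-fuse (λ _ → refl) E)) (k (λ i → ρ' (ρ i)))
𝒦-ren (A ⇒ B) ρ (E₁ , u , refl , hu , k₁) = renμE ρ E₁ , renμ ρ u , ∘E-renμ ρ E₁ (appE hole u) , ⟦⟧-ren ρ hu , 𝒦-ren B ρ k₁

⟦⟧-⟶ : ∀ {A t t'} → ⟦ A ⟧ t → t ⟶ t' → ⟦ A ⟧ t'
⟦⟧-⟶ h r ρ E k = SN-⟶ (h ρ E k) (plug-⟶ E (renμ-⟶ ρ r))

⟦⟧-at : ∀ {A t E} → ⟦ A ⟧ t → 𝒦 A E → SN (plug E t)
⟦⟧-at {A} {t} {E} h k = subst (λ z → SN (plug E z)) (renμ-id (λ _ → refl) t) (h (λ i → i) E k)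

𝒦Nat-Orth : ∀ {E} → 𝒦 Nat E → Orth E
𝒦Nat-Orth {E} k = subst Orth (renμE-id (λ _ → refl) E) (k (λ i → i))

mutual
  𝒦-neutral : ∀ A {E} → 𝒦 A E → ∀ F x → SNE F → SN (plug E (plug F (var x)))
  𝒦-neutral Nat     k F x sF = proj₂ (𝒦Nat-Orth k) F x sF
  𝒦-neutral (A ⇒ B) (E₁ , u , refl , hu , k₁) F x sF =
    subst SN (sym (plug-∘E E₁ (appE hole u) (plug F (var x))))
      (𝒦-neutral B k₁ (appE F u) x (sne-app sF (⟦⟧⇒SN A hu)))

  ⟦⟧⇒SN : ∀ A {t} → ⟦ A ⟧ t → SN t
  ⟦⟧⇒SN A {t} h = SN-plug-inv (proj₁ (𝒦-inhabited A)) (⟦⟧-at h (proj₂ (𝒦-inhabited A))) refl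

  𝒦-inhabited : ∀ A → Σ ECtx (𝒦 A)
  𝒦-inhabited Nat     = hole , λ ρ → (λ n → SN-Num (num-Num n)) , (λ F x sF → SN-var sF)
  𝒦-inhabited (A ⇒ B) = proj₁ (𝒦-inhabited B) ∘E appE hole (var 0) ,
                        proj₁ (𝒦-inhabited B) , var 0 , refl , var∈⟦⟧ A 0 , proj₂ (𝒦-inhabited B)

  var∈⟦⟧ : ∀ A x → ⟦ A ⟧ (var x)
  var∈⟦⟧ A x ρ E k = 𝒦-neutral A k hole x sne-hole

𝒦⇒SNE : ∀ A {E} → 𝒦 A E → SNE E
𝒦⇒SNE A k = SNE-plug-inv (𝒦-neutral A k hole 0 sne-hole) refl

num∈⟦⟧ : ∀ m → ⟦ Nat ⟧ (num m)
num∈⟦⟧ m ρ E k = subst (λ z → SN (plug E z)) (sym (num-renμ ρ m)) (proj₁ (𝒦Nat-Orth k) m)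

Orth-S : ∀ {E} → Orth E → Orth (E ∘E SE hole)
Orth-S {E} (onum , oneu) =
  (λ n → subst SN (sym (plug-∘E E (SE hole) (num n))) (onum (suc n))) ,
  (λ F x sF → subst SN (sym (plug-∘E E (SE hole) (plug F (var x)))) (oneu (SE F) x (sne-S sF)))

𝒦Nat-S : ∀ {E} → 𝒦 Nat E → 𝒦 Nat (E ∘E SE hole)
𝒦Nat-S {E} k ρ = subst Orth (sym (∘E-renμ ρ E (SE hole))) (Orth-S (k ρ))

-- Recursion on a numeral with reducible arguments, in a context of 𝒦 B,
-- is SN; by induction on the numeral, the recursive call being reducible.
SN-nrec-num : ∀ B n r s → ⟦ B ⟧ r → ⟦ Nat ⇒ B ⇒ B ⟧ s → ∀ E → 𝒦 B E → SN (plug E (nrec B r s (num n)))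
SN-nrec-num B zero    r s hr hs E k = SN-nrec0 B r s E (⟦⟧⇒SN _ hs) (⟦⟧-at hr k)
SN-nrec-num B (suc m) r s hr hs E k = SN-nrecS B r s (num m) (num-Num m) E (⟦⟧⇒SN _ hs) step-SN
  where
    N = nrec B r s (num m)
    N∈⟦⟧ : ⟦ B ⟧ N
    N∈⟦⟧ ρ E' k' = subst (λ z → SN (plug E' (nrec B (renμ ρ r) (renμ ρ s) z))) (sym (num-renμ ρ m))
                     (SN-nrec-num B m (renμ ρ r) (renμ ρ s) (⟦⟧-ren ρ hr) (⟦⟧-ren ρ hs) E' k')
    K : ECtx
    K = (E ∘E appE hole N) ∘E appE hole (num m)
    K∈𝒦 : 𝒦 (Nat ⇒ B ⇒ B) K
    K∈𝒦 = E ∘E appE hole N , num m , refl , num∈⟦⟧ m , (E , N , refl , N∈⟦⟧ , k)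
    step-SN : SN (plug E (app (app s (num m)) N))
    step-SN = subst SN (trans (plug-∘E (E ∘E appE hole N) (appE hole (num m)) s) (plug-∘E E (appE hole N) _))
                (⟦⟧-at hs K∈𝒦)

Orth-nrec : ∀ {B E r s} → 𝒦 B E → ⟦ B ⟧ r → ⟦ Nat ⇒ B ⇒ B ⟧ s → Orth (E ∘E nrecE B r s hole)
Orth-nrec {B} {E} {r} {s} k hr hs =
  (λ n → subst SN (sym (plug-∘E E (nrecE B r s hole) (num n))) (SN-nrec-num B n r s hr hs E k)) ,
  (λ F x sF → subst SN (sym (plug-∘E E (nrecE B r s hole) (plug F (var x))))
    (𝒦-neutral B k (nrecE B r s F) x (sne-nrec (⟦⟧⇒SN _ hr) (⟦⟧⇒SN _ hs) sF)))

𝒦Nat-nrec : ∀ {B E r s} → 𝒦 B E → ⟦ B ⟧ r → ⟦ Nat ⇒ B ⇒ B ⟧ s → 𝒦 Nat (E ∘E nrecE B r s hole)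
𝒦Nat-nrec {B} {E} {r} {s} k hr hs ρ =
  subst Orth (sym (∘E-renμ ρ E (nrecE B r s hole))) (Orth-nrec (𝒦-ren B ρ k) (⟦⟧-ren ρ hr) (⟦⟧-ren ρ hs))

zro∈⟦⟧ : ⟦ Nat ⟧ zro
zro∈⟦⟧ = num∈⟦⟧ 0

S∈⟦⟧ : ∀ {t} → ⟦ Nat ⟧ t → ⟦ Nat ⟧ (S t)
S∈⟦⟧ {t} ht ρ E k = subst SN (plug-∘E E (SE hole) (renμ ρ t)) (ht ρ (E ∘E SE hole) (𝒦Nat-S k))

nrec∈⟦⟧ : ∀ {B r s t} → ⟦ B ⟧ r → ⟦ Nat ⇒ B ⇒ B ⟧ s → ⟦ Nat ⟧ t → ⟦ B ⟧ (nrec B r s t)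
nrec∈⟦⟧ {B} {r} {s} {t} hr hs ht ρ E k =
  subst SN (plug-∘E E (nrecE B (renμ ρ r) (renμ ρ s) hole) (renμ ρ t))
    (ht ρ _ (𝒦Nat-nrec k (⟦⟧-ren ρ hr) (⟦⟧-ren ρ hs)))

app∈⟦⟧ : ∀ {A B t s} → ⟦ A ⇒ B ⟧ t → ⟦ A ⟧ s → ⟦ B ⟧ (app t s)
app∈⟦⟧ {t = t} {s} ht hs ρ E k =
  subst SN (plug-∘E E (appE hole (renμ ρ s)) (renμ ρ t))
    (ht ρ (E ∘E appE hole (renμ ρ s)) (E , renμ ρ s , refl , ⟦⟧-ren ρ hs , k))

lam∈⟦⟧ : ∀ {A B b} → (∀ ρ u → ⟦ A ⟧ u → ⟦ B ⟧ (renμ ρ b [0:= u ])) → ⟦ A ⇒ B ⟧ (lam A b)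
lam∈⟦⟧ {A} {B} {b} h ρ .(E₁ ∘E appE hole u) (E₁ , u , refl , hu , k₁) =
  subst SN (sym (plug-∘E E₁ (appE hole u) _))
    (SN-β A u hu (⟦⟧⇒SN A hu) (renμ ρ b) E₁ (λ u' hu' → ⟦⟧-at (h ρ u' hu') k₁) (⟦⟧-at (h ρ u hu) k₁))
  where open Expansion-β (⟦⟧-⟶ {A})

mu∈⟦⟧ : ∀ {A c} → (∀ ρ E → 𝒦 A E → SNC (ssubC 0 (renμE suc E) (renμC (lift ρ) c))) → ⟦ A ⟧ (mu A c)
mu∈⟦⟧ {A} h ρ E k = SN-μ (depth E) E refl (𝒦⇒SNE A k) A _ (h ρ E k)

-- Reducible instances.  A μ-name of type B may carry a context of 𝒦 B or
-- the empty context (a free name, as in the identity instance).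

𝒦⁰ : Ty → ECtx → Set
𝒦⁰ A E = 𝒦 A E ⊎ E ≡ hole

⟦⟧-at⁰ : ∀ {A t E} → ⟦ A ⟧ t → 𝒦⁰ A E → SN (plug E t)
⟦⟧-at⁰     h (inj₁ k)    = ⟦⟧-at h k
⟦⟧-at⁰ {A} h (inj₂ refl) = ⟦⟧⇒SN A h

RedS : Ctx → (ℕ → Tm) → Set
RedS Γ σ = ∀ {x B} → Γ ∋ x ∶ B → ⟦ B ⟧ (σ x)

RedK : Ctx → (ℕ → ECtx) → Set
RedK Δ π = ∀ {a B} → Δ ∋ a ∶ B → 𝒦⁰ B (π a)

RedS-cons : ∀ {Γ σ A u} → ⟦ A ⟧ u → RedS Γ σ → RedS (A ∷ Γ) (consT u σ)
RedS-cons hu hσ here        = hu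
RedS-cons hu hσ (there x∈) = hσ x∈

RedS-ren : ∀ {Γ σ} ρ → RedS Γ σ → RedS Γ (λ i → renμ ρ (σ i))
RedS-ren ρ hσ x∈ = ⟦⟧-ren ρ (hσ x∈)

RedK-cons : ∀ {Δ π A E} → 𝒦⁰ A E → RedK Δ π → RedK (A ∷ Δ) (consE E π)
RedK-cons hE hπ here        = hE
RedK-cons hE hπ (there a∈) = hπ a∈

RedK-ren : ∀ {Δ π} ρ → RedK Δ π → RedK Δ (λ a → renμE ρ (π a))
RedK-ren {Δ} {π} ρ hπ {a} {B} a∈ with π a | hπ a∈
... | E | inj₁ k    = inj₁ (𝒦-ren B ρ k)
... | _ | inj₂ refl = inj₂ refl

mutual
  adequacy : ∀ {Γ Δ t A} → Γ ︔ Δ ⊢ t ∶ A → ∀ σ ρ π → RedS Γ σ → RedK Δ π → ⟦ A ⟧ (inst σ ρ π t)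
  adequacy (⊢var x∈) σ ρ π hσ hπ = hσ x∈
  adequacy (⊢lam {B = B} {t} d) σ ρ π hσ hπ = lam∈⟦⟧ λ ρ' u hu →
    subst ⟦ B ⟧ (sym (inst-β σ ρ π ρ' u t)) (adequacy d _ _ _ (RedS-cons hu (RedS-ren ρ' hσ)) (RedK-ren ρ' hπ))
  adequacy (⊢app d e)          σ ρ π hσ hπ = app∈⟦⟧ (adequacy d σ ρ π hσ hπ) (adequacy e σ ρ π hσ hπ)
  adequacy ⊢zro                σ ρ π hσ hπ = zro∈⟦⟧
  adequacy (⊢S d)              σ ρ π hσ hπ = S∈⟦⟧ (adequacy d σ ρ π hσ hπ)
  adequacy (⊢nrec dr ds dt)    σ ρ π hσ hπ =
    nrec∈⟦⟧ (adequacy dr σ ρ π hσ hπ) (adequacy ds σ ρ π hσ hπ) (adequacy dt σ ρ π hσ hπ)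
  adequacy (⊢mu {A = A} {c} d) σ ρ π hσ hπ = mu∈⟦⟧ λ ρ' E k →
    subst SNC (sym (inst-μ σ ρ π ρ' E c))
      (adequacyC d _ _ _ (RedS-ren (λ i → suc (ρ' i)) hσ) (RedK-cons (inj₁ (𝒦-ren A suc k)) (RedK-ren _ hπ)))

  adequacyC : ∀ {Γ Δ c} → Γ ︔ Δ ⊢C c → ∀ σ ρ π → RedS Γ σ → RedK Δ π → SNC (instC σ ρ π c)
  adequacyC (⊢named d a∈) σ ρ π hσ hπ = SN-named (⟦⟧-at⁰ (adequacy d σ ρ π hσ hπ) (hπ a∈))

-- Strong normalisation: a typed term is its own identity instance, which is
-- reducible because variables are reducible and free names carry □.
corollary6p29 : (Γ Δ : Ctx) (t : Tm) (ρ : Ty) → Γ ︔ Δ ⊢ t ∶ ρ → SN t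
corollary6p29 Γ Δ t ρ d = subst SN (inst-id (λ _ → refl) (λ _ → refl) (λ _ → refl) t) (⟦⟧⇒SN ρ t-reducible)
  where
    t-reducible : ⟦ ρ ⟧ (inst var (λ a → a) (λ _ → hole) t)
    t-reducible = adequacy d var (λ a → a) (λ _ → hole) (λ {x} {B} _ → var∈⟦⟧ B x) (λ _ → inj₂ refl)
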